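{- Let $n_0,n_1,\dots,n_k$ be positive integers, $n=\sum_{i=0}^k n_i$, and $G\cong K_{n_0}\vee(K_{n_1}\cup K_{n_2}\cup\cdots\cup K_{n_k})$. Then the $\mathcal{H}$-spectrum of $G$ is the multiset consisting of $n$ with multiplicity $\frac{n_0(n_0+1)}{2}$, $n_0$ with multiplicity $n_0(k-1)$, and, for each $1\le i\le k$, $n_0+n_i$ with multiplicity $\frac{(2n_0+n_i)(n_i-1)}{2}$ (multiplicities of coinciding values being added).
   Context: $G_1\vee G_2$ denotes the join (disjoint union plus all edges between the two vertex sets), $\cup$ the disjoint union, $K_r$ the complete graph. Graphs are finite, simple and undirected. Fix an orientation of every edge (tail $e^-$, head $e^+$) and a cyclic orientation of every triangle. Let $\mathcal{B}$ be the $|E|\times|V|$ matrix with $b_{ev}=-1$ if $v=e^-$, $1$ if $v=e^+$, $0$ otherwise, and $\mathcal{C}$ the $|T|\times|E|$ matrix ($T$ the set of triangles) with $c_{\vartriangle e}=\pm1$ if $e$ is an edge of $\vartriangle$ (sign $+$ iff the orientation of $e$ agrees with that of $\vartriangle$) and $0$ otherwise. The Helmholtzian matrix is $\mathcal{H}(G)=\mathcal{B}\mathcal{B}^{\intercal}+\mathcal{C}^{\intercal}\mathcal{C}$; its spectrum (the $\mathcal{H}$-spectrum) does not depend on the chosen orientations. -}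

module Defs where

open import Data.Bool using (Bool; true; false; if_then_else_; _∧_; _∨_)
open import Data.Nat as ℕ using (ℕ; zero; suc)
open import Data.Fin as F using (Fin; zero; suc; toℕ; punchIn)
open import Data.Fin.Properties using (_≟_)
open import Data.List using (List; []; _∷_; concatMap; length; lookup; foldr; map)
open import Data.List as L using (allFin)
open import Data.Nat.ListAction using (sum)
open import Data.Product using (_×_; _,_)
open import Data.Integer as ℤ using (ℤ; +_; _-_; _*_; _^_)
open import Relation.Nullary.Decidable using (⌊_⌋)

sumℤ : List ℤ → ℤ
sumℤ = foldr ℤ._+_ (+ 0)

altSum : ∀ {m} → (Fin m → ℤ) → ℤ
altSum {zero}  f = + 0
altSum {suc m} f = f zero - altSum (λ j → f (suc j))

Matrix : ℕ → Set
Matrix m = Fin m → Fin m → ℤ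

det : ∀ {m} → Matrix m → ℤ
det {zero}  A = + 1
det {suc m} A = altSum (λ j → A zero j * det (λ r c → A (suc r) (punchIn j c)))

charPolyAt : ∀ {m} → Matrix m → ℤ → ℤ
charPolyAt A x = det (λ i j → (if ⌊ i ≟ j ⌋ then x else + 0) - A i j)

-- Graphs on vertex set Fin N, given by a (symmetric, irreflexive)
-- adjacency predicate.  Only pairs i < j are consulted.

Graph : ℕ → Set
Graph N = Fin N → Fin N → Bool

_<F_ : ∀ {N} → Fin N → Fin N → Bool
i <F j = toℕ i ℕ.<ᵇ toℕ j

_==F_ : ∀ {N} → Fin N → Fin N → Bool
i ==F j = ⌊ i ≟ j ⌋

-- edges {i,j}, i < j, oriented i → j (tail i, head j)
edges : ∀ {N} → Graph N → List (Fin N × Fin N)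
edges {N} G =
  concatMap (λ i → concatMap (λ j →
    if (i <F j) ∧ G i j then (i , j) ∷ [] else []) (allFin N)) (allFin N)

-- triangles {i,j,l}, i < j < l, cyclically oriented i → j → l → i
triangles : ∀ {N} → Graph N → List (Fin N × Fin N × Fin N)
triangles {N} G =
  concatMap (λ i → concatMap (λ j → concatMap (λ l →
    if (i <F j) ∧ (j <F l) ∧ G i j ∧ G j l ∧ G i l
    then (i , j , l) ∷ [] else []) (allFin N)) (allFin N)) (allFin N)

bEntry : ∀ {N} → Fin N × Fin N → Fin N → ℤ
bEntry (t , h) v =
  if v ==F h then + 1 else if v ==F t then ℤ.-_ (+ 1) else + 0

_==E_ : ∀ {N} → Fin N × Fin N → Fin N × Fin N → Bool
(a , b) ==E (c , d) = (a ==F c) ∧ (b ==F d)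

cEntry : ∀ {N} → Fin N × Fin N × Fin N → Fin N × Fin N → ℤ
cEntry (i , j , l) e =
  if (e ==E (i , j)) ∨ (e ==E (j , l)) then + 1
  else if e ==E (i , l) then ℤ.-_ (+ 1) else + 0

helmholtzian : ∀ {N} → (G : Graph N) → Matrix (length (edges G))
helmholtzian {N} G e f =
  sumℤ (map (λ v → bEntry ee v * bEntry ff v) (allFin N)) ℤ.+
  sumℤ (map (λ t → cEntry t ee * cEntry t ff) (triangles G))
  where
    ee = lookup (edges G) e
    ff = lookup (edges G) f

-- The graph K_{n0} ∨ (K_{n1} ∪ ... ∪ K_{nk}) on Fin (n0 + n1 + ... + nk).
-- Vertices 0 .. n0-1 form K_{n0}; the following n1 vertices form K_{n1}, etc.

blockOf : List ℕ → ℕ → ℕ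
blockOf []       x = 0
blockOf (m ∷ ms) x = if x ℕ.<ᵇ m then 0 else suc (blockOf ms (x ℕ.∸ m))

part : ℕ → List ℕ → ℕ → ℕ
part n0 ns v = if v ℕ.<ᵇ n0 then 0 else suc (blockOf ns (v ℕ.∸ n0))

joinGraph : (n0 : ℕ) (ns : List ℕ) → Graph (n0 ℕ.+ sum ns)
joinGraph n0 ns u v =
  if u ==F v then false
  else (p u ℕ.≡ᵇ 0) ∨ (p v ℕ.≡ᵇ 0) ∨ (p u ℕ.≡ᵇ p v)
  where
    p : Fin (n0 ℕ.+ sum ns) → ℕ
    p w = part n0 ns (toℕ w)

-- The claimed spectrum, as the polynomial ∏ (x - λ)^{mult λ}, evaluated at x.

specPoly : (n0 : ℕ) (ns : List ℕ) → ℤ → ℤ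
specPoly n0 ns x =
  (x - + n) ^ ((n0 ℕ.* (n0 ℕ.+ 1)) ℕ./ 2) *
  ((x - + n0) ^ (n0 ℕ.* (length ns ℕ.∸ 1)) *
   foldr _*_ (+ 1)
     (map (λ ni → (x - + (n0 ℕ.+ ni)) ^ (((2 ℕ.* n0 ℕ.+ ni) ℕ.* (ni ℕ.∸ 1)) ℕ./ 2)) ns))
  where
    n = n0 ℕ.+ sum ns

-- Order the vertices with K_{n0} first and orient every edge from its smaller to its larger end.
-- Two edges with different tails interact only through a common end, and the triangle they span
-- cancels that interaction, so 𝓗 is block diagonal with one block per tail.  For a tail in a block
-- K_{nᵢ} the block is (n0 + nᵢ) I.  For a tail in K_{n0} it is n I on the later inner heads and, on
-- the outer heads, the matrix with n0 + nᵢ on the diagonal and 1 between vertices of distinct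
-- blocks; the characteristic polynomial of the latter follows by Gaussian elimination, merging first
-- the vertices of each block and then the blocks.

{-# OPTIONS --safe #-}
module Submission where

open import Defs
open import Algebra.Bundles using (Monoid)
open import Data.Bool using (Bool; true; false; T; if_then_else_; _∧_; _∨_)
open import Data.Bool.Properties using (T-≡; T-∧; T-∨; ∧-identityʳ; ∧-zeroʳ; ∧-comm)
open import Data.Empty using (⊥-elim)
open import Data.Fin as Fin using (Fin; zero; suc; toℕ; punchIn; punchOut; inject₁; _↑ˡ_; _↑ʳ_; cast)
import Data.Fin.Properties as Finₚ
open import Data.Integer as ℤ using (ℤ; +_; _+_; _-_; _*_; -_; _^_; -1ℤ)
import Data.Integer.Properties as ℤₚ
open import Data.Integer.Tactic.RingSolver using (solve-∀)
open import Data.List using (List; []; _∷_; _++_; length; lookup; tabulate; concat; concatMap; replicate; map; foldr; allFin)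
import Data.List.Properties as Listₚ
open import Data.List.Membership.Propositional.Properties using (∈-lookup)
open import Data.List.Relation.Unary.All as All using (All; []; _∷_)
open import Data.List.Relation.Unary.All.Properties using (++⁺; concat⁺; tabulate⁺; replicate⁺)
open import Data.Nat as ℕ using (ℕ; zero; suc; _≤_; _<_; _∸_; s≤s; z≤n)
open import Data.Nat.DivMod using (m*n/n≡m)
open import Data.Nat.ListAction using (sum)
import Data.Nat.Properties as ℕₚ
import Data.Nat.Tactic.RingSolver as ℕ-Solver
open import Data.Product using (Σ; _×_; _,_; proj₁; proj₂)
open import Data.Sum using (_⊎_; inj₁; inj₂)
open import Data.Vec.Functional using (updateAt)
open import Data.Vec.Functional.Properties using (updateAt-updates; updateAt-minimal)
open import Function using (_∘_)
open import Function.Bundles using (Equivalence)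
open import Relation.Binary.Definitions using (tri<; tri≈; tri>)
open import Relation.Binary.PropositionalEquality
open import Relation.Nullary using (¬_; yes; no)
open import Relation.Nullary.Decidable using (⌊_⌋)

open import Algebra.Properties.Semiring.Sum ℤₚ.+-*-semiring
  using (sum-cong-≗; ∑-distrib-+; *-distribˡ-sum; sum-replicate-zero) renaming (sum to ∑)
open import Algebra.Properties.CommutativeMonoid.Sum ℤₚ.*-1-commutativeMonoid
  using () renaming (sum to ∏; sum-cong-≗ to ∏-cong; ∑-distrib-+ to ∏-distrib-*; sum-replicate-zero to ∏-const-1)

-- Determinants

sign : ℕ → ℤ
sign k = -1ℤ ^ k

sign-+ : ∀ a b → sign (a ℕ.+ b) ≡ sign a * sign b
sign-+ = ℤₚ.^-distribˡ-+-* -1ℤ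

sign-double : ∀ k → sign (k ℕ.+ k) ≡ + 1
sign-double k = begin
  sign (k ℕ.+ k)        ≡⟨ cong (λ l → sign (k ℕ.+ l)) (sym (ℕₚ.+-identityʳ k)) ⟩
  sign (2 ℕ.* k)        ≡⟨ sym (ℤₚ.^-*-assoc -1ℤ 2 k) ⟩
  (+ 1) ^ k             ≡⟨ ℤₚ.^-zeroˡ k ⟩
  + 1                   ∎
  where open ≡-Reasoning

altSum-cong : ∀ {m} {f g : Fin m → ℤ} → (∀ j → f j ≡ g j) → altSum f ≡ altSum g
altSum-cong {zero}  f≗g = refl
altSum-cong {suc m} f≗g = cong₂ _-_ (f≗g zero) (altSum-cong (f≗g ∘ suc))

altSum-zero : ∀ {m} {f : Fin m → ℤ} → (∀ j → f j ≡ + 0) → altSum f ≡ + 0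
altSum-zero {zero}  f≗0 = refl
altSum-zero {suc m} f≗0 = cong₂ _-_ (f≗0 zero) (altSum-zero (f≗0 ∘ suc))

altSum-+ : ∀ {m} (f g : Fin m → ℤ) → altSum (λ j → f j + g j) ≡ altSum f + altSum g
altSum-+ {zero}  f g = refl
altSum-+ {suc m} f g = trans (cong (_-_ (f zero + g zero)) (altSum-+ (f ∘ suc) (g ∘ suc)))
  (interchange (f zero) (g zero) (altSum (f ∘ suc)) (altSum (g ∘ suc)))
  where
  interchange : ∀ a b c d → a + b - (c + d) ≡ a - c + (b - d)
  interchange = solve-∀

altSum-* : ∀ {m} (c : ℤ) (f : Fin m → ℤ) → altSum (λ j → c * f j) ≡ c * altSum f
altSum-* {zero}  c f = sym (ℤₚ.*-zeroʳ c)
altSum-* {suc m} c f = trans (cong (_-_ (c * f zero)) (altSum-* c (f ∘ suc)))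
  (factor c (f zero) (altSum (f ∘ suc)))
  where
  factor : ∀ c a b → c * a - c * b ≡ c * (a - b)
  factor = solve-∀

altSum-neg : ∀ {m} (f : Fin m → ℤ) → altSum (λ j → - f j) ≡ - altSum f
altSum-neg f = trans (altSum-cong (λ j → sym (ℤₚ.-1*i≡-i (f j))))
  (trans (altSum-* -1ℤ f) (ℤₚ.-1*i≡-i (altSum f)))

altSum-single : ∀ {m} (s : Fin m) (f : Fin m → ℤ) → (∀ j → j ≢ s → f j ≡ + 0) →
  altSum f ≡ sign (toℕ s) * f s
altSum-single {suc m} zero f vanish =
  trans (cong (_-_ (f zero)) (altSum-zero (λ j → vanish (suc j) (λ ()))))
    (trans (ℤₚ.+-identityʳ (f zero)) (sym (ℤₚ.*-identityˡ (f zero))))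
altSum-single {suc m} (suc s) f vanish =
  trans (cong₂ _-_ (vanish zero (λ ())) (altSum-single s (f ∘ suc) (λ j j≢s → vanish (suc j) (j≢s ∘ Finₚ.suc-injective))))
    (negate (sign (toℕ s)) (f (suc s)))
  where
  negate : ∀ a b → + 0 - a * b ≡ - (+ 1) * a * b
  negate = solve-∀

-- two equal adjacent terms carry opposite signs
altSum-cancel : ∀ {m} (p : Fin (suc m)) (f : Fin (suc (suc m)) → ℤ) →
  (∀ j → j ≢ inject₁ p → j ≢ suc p → f j ≡ + 0) → f (inject₁ p) ≡ f (suc p) → altSum f ≡ + 0
altSum-cancel {m} zero f vanish f₀≡f₁ =
  trans (cong (λ t → f zero - (f (suc zero) - t)) (altSum-zero (λ j → vanish (suc (suc j)) (λ ()) (λ ()))))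
    (trans (cong (λ t → t - (f (suc zero) - + 0)) f₀≡f₁) (cancel (f (suc zero))))
  where
  cancel : ∀ a → a - (a - + 0) ≡ + 0
  cancel = solve-∀
altSum-cancel {suc m} (suc p) f vanish fp≡fp₁ =
  cong₂ _-_ (vanish zero (λ ()) (λ ()))
    (altSum-cancel p (f ∘ suc) (λ j j≢p j≢p₁ → vanish (suc j) (j≢p ∘ Finₚ.suc-injective) (j≢p₁ ∘ Finₚ.suc-injective)) fp≡fp₁)

altSum-++ : ∀ a d (f : Fin (a ℕ.+ d) → ℤ) →
  altSum f ≡ altSum (λ j → f (j ↑ˡ d)) + sign a * altSum (λ j → f (a ↑ʳ j))
altSum-++ zero    d f = sym (trans (ℤₚ.+-identityˡ _) (ℤₚ.*-identityˡ _))
altSum-++ (suc a) d f =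
  trans (cong (_-_ (f zero)) (altSum-++ a d (f ∘ suc)))
    (regroup (f zero) (altSum (λ j → f (suc (j ↑ˡ d)))) (sign a) (altSum (λ j → f (suc (a ↑ʳ j)))))
  where
  regroup : ∀ x y s z → x - (y + s * z) ≡ x - y + - (+ 1) * s * z
  regroup = solve-∀

minor : ∀ {m} → Matrix (suc m) → Fin (suc m) → Matrix m
minor A j r c = A (suc r) (punchIn j c)

det-cong : ∀ {m} {A B : Matrix m} → (∀ i j → A i j ≡ B i j) → det A ≡ det B
det-cong {zero}  A≗B = refl
det-cong {suc m} A≗B = altSum-cong (λ j → cong₂ _*_ (A≗B zero j) (det-cong (λ r c → A≗B (suc r) (punchIn j c))))

det-expansion-+ : ∀ {m} (A B C : Matrix (suc m)) →
  (∀ j → A zero j * det (minor A j) ≡ B zero j * det (minor B j) + C zero j * det (minor C j)) →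
  det A ≡ det B + det C
det-expansion-+ A B C terms = trans (altSum-cong terms)
  (altSum-+ (λ j → B zero j * det (minor B j)) (λ j → C zero j * det (minor C j)))

det-row-+ : ∀ {m} (r : Fin m) (A B C : Matrix m) →
  (∀ i j → i ≢ r → A i j ≡ B i j) → (∀ i j → i ≢ r → A i j ≡ C i j) →
  (∀ j → A r j ≡ B r j + C r j) → det A ≡ det B + det C
det-row-+ {suc m} zero A B C A≡B A≡C rowA = det-expansion-+ A B C λ j → begin
  A zero j * det (minor A j)                                 ≡⟨ cong (_* det (minor A j)) (rowA j) ⟩
  (B zero j + C zero j) * det (minor A j)                    ≡⟨ ℤₚ.*-distribʳ-+ (det (minor A j)) (B zero j) (C zero j) ⟩
  B zero j * det (minor A j) + C zero j * det (minor A j)    ≡⟨ cong₂ _+_ (cong (B zero j *_) (det-cong (λ r c → A≡B (suc r) _ (λ ()))))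
                                                                         (cong (C zero j *_) (det-cong (λ r c → A≡C (suc r) _ (λ ())))) ⟩
  B zero j * det (minor B j) + C zero j * det (minor C j)    ∎
  where open ≡-Reasoning
det-row-+ {suc m} (suc q) A B C A≡B A≡C rowA = det-expansion-+ A B C λ j → begin
  A zero j * det (minor A j)                                 ≡⟨ cong₂ _*_ (A≡B zero j (λ ()))
                                                                 (det-row-+ q (minor A j) (minor B j) (minor C j)
                                                                   (λ i c i≢q → A≡B (suc i) _ (i≢q ∘ Finₚ.suc-injective))
                                                                   (λ i c i≢q → A≡C (suc i) _ (i≢q ∘ Finₚ.suc-injective))
                                                                   (λ c → rowA _)) ⟩
  B zero j * (det (minor B j) + det (minor C j))             ≡⟨ ℤₚ.*-distribˡ-+ (B zero j) (det (minor B j)) (det (minor C j)) ⟩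
  B zero j * det (minor B j) + B zero j * det (minor C j)    ≡⟨ cong (λ b → B zero j * det (minor B j) + b * det (minor C j))
                                                                 (trans (sym (A≡B zero j (λ ()))) (A≡C zero j (λ ()))) ⟩
  B zero j * det (minor B j) + C zero j * det (minor C j)    ∎
  where open ≡-Reasoning

det-row-* : ∀ {m} (r : Fin m) (c : ℤ) (A B : Matrix m) →
  (∀ i j → i ≢ r → A i j ≡ B i j) → (∀ j → A r j ≡ c * B r j) → det A ≡ c * det B
det-row-* {suc m} zero c A B A≡B rowA = trans (altSum-cong term) (altSum-* c (λ j → B zero j * det (minor B j)))
  where
  term : ∀ j → A zero j * det (minor A j) ≡ c * (B zero j * det (minor B j))
  term j = trans (cong₂ _*_ (rowA j) (det-cong (λ r _ → A≡B (suc r) _ (λ ())))) (ℤₚ.*-assoc c (B zero j) (det (minor B j)))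
det-row-* {suc m} (suc q) c A B A≡B rowA = trans (altSum-cong term) (altSum-* c (λ j → B zero j * det (minor B j)))
  where
  swap : ∀ a b c → a * (c * b) ≡ c * (a * b)
  swap = solve-∀
  term : ∀ j → A zero j * det (minor A j) ≡ c * (B zero j * det (minor B j))
  term j = trans (cong₂ _*_ (A≡B zero j (λ ()))
                   (det-row-* q c (minor A j) (minor B j) (λ i _ i≢q → A≡B (suc i) _ (i≢q ∘ Finₚ.suc-injective)) (λ _ → rowA _)))
             (swap (B zero j) (det (minor B j)) c)

det-zero-row : ∀ {m} (r : Fin m) (A : Matrix m) → (∀ j → A r j ≡ + 0) → det A ≡ + 0
det-zero-row r A row≡0 = det-row-* r (+ 0) A A (λ _ _ _ → refl) row≡0

-- Expanding a determinant along two equal leading rows: the terms for the column pairs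
-- (j, k) and (k, j) cancel.  Ψ stands for the determinant of the remaining rows,
-- as a function of the columns kept.
expansion-equal-leading-rows : ∀ m (a : Fin (suc (suc m)) → ℤ) (Ψ : (Fin m → Fin (suc (suc m))) → ℤ) →
  (∀ σ τ → (∀ x → σ x ≡ τ x) → Ψ σ ≡ Ψ τ) →
  altSum (λ j → a j * altSum (λ c → a (punchIn j c) * Ψ (punchIn j ∘ punchIn c))) ≡ + 0
expansion-equal-leading-rows m a Ψ Ψ-ext = begin
  X - altSum (λ j → a (suc j) * (a zero * Ψ (punchIn (suc j) ∘ punchIn zero) - R j))
    ≡⟨ cong (_-_ X) (altSum-cong (λ j → distrib (a (suc j)) (a zero * Ψ (punchIn (suc j) ∘ punchIn zero)) (R j))) ⟩
  X - altSum (λ j → P j + - (a (suc j) * R j))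
    ≡⟨ cong (_-_ X) (trans (altSum-+ P (λ j → - (a (suc j) * R j))) (cong (_+_ (altSum P)) (altSum-neg (λ j → a (suc j) * R j)))) ⟩
  X - (altSum P - altSum (λ j → a (suc j) * R j))
    ≡⟨ cong (λ t → X - (t - altSum (λ j → a (suc j) * R j))) P≡X ⟩
  X - (X - altSum (λ j → a (suc j) * R j))
    ≡⟨ cong (λ t → X - (X - t)) (tail-vanishes m a Ψ Ψ-ext) ⟩
  X - (X - + 0)
    ≡⟨ cancel X ⟩
  + 0 ∎
  where
  open ≡-Reasoning
  distrib : ∀ a b c → a * (b - c) ≡ a * b + - (a * c)
  distrib = solve-∀
  cancel : ∀ a → a - (a - + 0) ≡ + 0
  cancel = solve-∀
  rotate : ∀ a b c → a * (b * c) ≡ b * (a * c)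
  rotate = solve-∀
  X = a zero * altSum (λ c → a (suc c) * Ψ (suc ∘ punchIn c))
  P : Fin (suc m) → ℤ
  P j = a (suc j) * (a zero * Ψ (punchIn (suc j) ∘ punchIn zero))
  R : Fin (suc m) → ℤ
  R j = altSum (λ c → a (suc (punchIn j c)) * Ψ (punchIn (suc j) ∘ punchIn (suc c)))
  P≡X : altSum P ≡ X
  P≡X = trans (altSum-cong (λ j → rotate (a (suc j)) (a zero) (Ψ (suc ∘ punchIn j))))
          (altSum-* (a zero) (λ c → a (suc c) * Ψ (suc ∘ punchIn c)))
  tail-vanishes : ∀ m (a : Fin (suc (suc m)) → ℤ) (Ψ : (Fin m → Fin (suc (suc m))) → ℤ) →
    (∀ σ τ → (∀ x → σ x ≡ τ x) → Ψ σ ≡ Ψ τ) →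
    altSum (λ j → a (suc j) * altSum (λ c → a (suc (punchIn j c)) * Ψ (punchIn (suc j) ∘ punchIn (suc c)))) ≡ + 0
  tail-vanishes zero    a Ψ Ψ-ext = altSum-zero (λ j → ℤₚ.*-zeroʳ (a (suc j)))
  tail-vanishes (suc m) a Ψ Ψ-ext =
    trans (altSum-cong (λ j → cong (a (suc j) *_) (altSum-cong (λ c → cong (a (suc (punchIn j c)) *_)
            (Ψ-ext (punchIn (suc j) ∘ punchIn (suc c)) (Fin.lift 1 (punchIn j ∘ punchIn c)) (λ { zero → refl ; (suc x) → refl }))))))
      (expansion-equal-leading-rows m (a ∘ suc) (Ψ ∘ Fin.lift 1)
        (λ σ τ σ≗τ → Ψ-ext (Fin.lift 1 σ) (Fin.lift 1 τ) (λ { zero → refl ; (suc x) → cong suc (σ≗τ x) })))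

det-equal-adjacent-rows : ∀ {m} (p : Fin (suc m)) (A : Matrix (suc (suc m))) →
  (∀ j → A (inject₁ p) j ≡ A (suc p) j) → det A ≡ + 0
det-equal-adjacent-rows {m} zero A rows≡ =
  trans (altSum-cong (λ j → cong (A zero j *_) (altSum-cong (λ c →
          cong (_* det (λ r c′ → A (suc (suc r)) (punchIn j (punchIn c c′)))) (sym (rows≡ (punchIn j c)))))))
    (expansion-equal-leading-rows m (A zero) (λ σ → det (λ r c → A (suc (suc r)) (σ c)))
      (λ σ τ σ≗τ → det-cong (λ r c → cong (A (suc (suc r))) (σ≗τ c))))
det-equal-adjacent-rows {suc m} (suc p) A rows≡ =
  altSum-zero (λ j → trans (cong (A zero j *_) (det-equal-adjacent-rows p (minor A j) (λ c → rows≡ _))) (ℤₚ.*-zeroʳ (A zero j)))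

det-col-+ : ∀ {m} (s : Fin m) (A B C : Matrix m) →
  (∀ i j → j ≢ s → A i j ≡ B i j) → (∀ i j → j ≢ s → A i j ≡ C i j) →
  (∀ i → A i s ≡ B i s + C i s) → det A ≡ det B + det C
det-col-+ {suc m} s A B C A≡B A≡C colA = det-expansion-+ A B C term
  where
  term : ∀ j → A zero j * det (minor A j) ≡ B zero j * det (minor B j) + C zero j * det (minor C j)
  term j with j Fin.≟ s
  ... | yes refl =
    trans (cong (_* det (minor A j)) (colA zero))
      (trans (ℤₚ.*-distribʳ-+ (det (minor A j)) (B zero j) (C zero j))
        (cong₂ _+_ (cong (B zero j *_) (det-cong (λ r c → A≡B (suc r) _ (Finₚ.punchInᵢ≢i j c))))
                   (cong (C zero j *_) (det-cong (λ r c → A≡C (suc r) _ (Finₚ.punchInᵢ≢i j c))))))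
  ... | no j≢s =
    trans (cong₂ _*_ (A≡B zero j j≢s)
            (det-col-+ (punchOut j≢s) (minor A j) (minor B j) (minor C j)
              (λ i c c≢s → A≡B (suc i) _ (c≢s ∘ punched))
              (λ i c c≢s → A≡C (suc i) _ (c≢s ∘ punched))
              (λ i → subst (λ k → A (suc i) k ≡ B (suc i) k + C (suc i) k) (sym (Finₚ.punchIn-punchOut j≢s)) (colA (suc i)))))
      (trans (ℤₚ.*-distribˡ-+ (B zero j) (det (minor B j)) (det (minor C j)))
        (cong (λ b → B zero j * det (minor B j) + b * det (minor C j)) (trans (sym (A≡B zero j j≢s)) (A≡C zero j j≢s))))
    where
    punched : ∀ {c} → punchIn j c ≡ s → c ≡ punchOut j≢s
    punched eq = Finₚ.punchIn-injective j _ _ (trans eq (sym (Finₚ.punchIn-punchOut j≢s)))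

inject₁≢suc : ∀ {m} (p : Fin m) → inject₁ p ≢ suc p
inject₁≢suc zero    ()
inject₁≢suc (suc p) eq = inject₁≢suc p (Finₚ.suc-injective eq)

punchIn-inject₁ : ∀ {m} (p : Fin (suc m)) → punchIn (inject₁ p) p ≡ suc p
punchIn-inject₁ zero          = refl
punchIn-inject₁ {suc m} (suc p) = cong suc (punchIn-inject₁ p)

-- deleting column j keeps the adjacent columns p, p+1 adjacent
punchIn-keeps-adjacent : ∀ {m} (j : Fin (suc (suc (suc m)))) (p : Fin (suc (suc m))) → j ≢ inject₁ p → j ≢ suc p →
  Σ (Fin (suc m)) λ p′ → (punchIn j (inject₁ p′) ≡ inject₁ p) × (punchIn j (suc p′) ≡ suc p)
punchIn-keeps-adjacent zero zero j≢p _ = ⊥-elim (j≢p refl)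
punchIn-keeps-adjacent zero (suc q) _ _ = q , refl , refl
punchIn-keeps-adjacent (suc zero) zero _ j≢p₁ = ⊥-elim (j≢p₁ refl)
punchIn-keeps-adjacent (suc (suc j)) zero _ _ = zero , refl , refl
punchIn-keeps-adjacent {zero} (suc zero) (suc zero) j≢p _ = ⊥-elim (j≢p refl)
punchIn-keeps-adjacent {zero} (suc (suc zero)) (suc zero) _ j≢p₁ = ⊥-elim (j≢p₁ refl)
punchIn-keeps-adjacent {suc m} (suc j) (suc q) j≢p j≢p₁
  with punchIn-keeps-adjacent {m} j q (j≢p ∘ cong suc) (j≢p₁ ∘ cong suc)
... | p′ , eq₁ , eq₂ = suc p′ , cong suc eq₁ , cong suc eq₂

-- deleting column p or column p+1 leaves the same columns, except that p+1 takes the place of p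
punchIn-adjacent : ∀ {m} (p c : Fin (suc m)) →
  (punchIn (inject₁ p) c ≡ punchIn (suc p) c) ⊎ ((punchIn (inject₁ p) c ≡ suc p) × (punchIn (suc p) c ≡ inject₁ p))
punchIn-adjacent zero zero = inj₂ (refl , refl)
punchIn-adjacent zero (suc c) = inj₁ refl
punchIn-adjacent {suc m} (suc p) zero = inj₁ refl
punchIn-adjacent {suc m} (suc p) (suc c) with punchIn-adjacent p c
... | inj₁ eq = inj₁ (cong suc eq)
... | inj₂ (eq₁ , eq₂) = inj₂ (cong suc eq₁ , cong suc eq₂)

det-equal-adjacent-cols : ∀ {m} (p : Fin (suc m)) (A : Matrix (suc (suc m))) →
  (∀ i → A i (inject₁ p) ≡ A i (suc p)) → det A ≡ + 0
det-equal-adjacent-cols p A cols≡ = altSum-cancel p (λ j → A zero j * det (minor A j)) (vanish p A cols≡)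
  (cong₂ _*_ (cols≡ zero) (det-cong same-minor))
  where
  same-minor : ∀ r c → A (suc r) (punchIn (inject₁ p) c) ≡ A (suc r) (punchIn (suc p) c)
  same-minor r c with punchIn-adjacent p c
  ... | inj₁ eq = cong (A (suc r)) eq
  ... | inj₂ (eq₁ , eq₂) = trans (cong (A (suc r)) eq₁) (trans (sym (cols≡ (suc r))) (cong (A (suc r)) (sym eq₂)))
  vanish : ∀ {m} (p : Fin (suc m)) (A : Matrix (suc (suc m))) → (∀ i → A i (inject₁ p) ≡ A i (suc p)) →
    ∀ j → j ≢ inject₁ p → j ≢ suc p → A zero j * det (minor A j) ≡ + 0
  vanish {zero} zero _ _ zero j≢p _ = ⊥-elim (j≢p refl)
  vanish {zero} zero _ _ (suc zero) _ j≢p₁ = ⊥-elim (j≢p₁ refl)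
  vanish {suc m} p A cols≡ j j≢p j≢p₁ with punchIn-keeps-adjacent j p j≢p j≢p₁
  ... | p′ , eq₁ , eq₂ = trans (cong (A zero j *_) (det-equal-adjacent-cols p′ (minor A j)
                           (λ i → trans (cong (A (suc i)) eq₁) (trans (cols≡ (suc i)) (cong (A (suc i)) (sym eq₂))))))
                           (ℤₚ.*-zeroʳ (A zero j))

punchIn-↑ʳ : ∀ {a d} (j : Fin (suc a)) (c : Fin d) → punchIn (j ↑ˡ d) (a ↑ʳ c) ≡ suc a ↑ʳ c
punchIn-↑ʳ zero c = refl
punchIn-↑ʳ {suc a} (suc j) c = cong suc (punchIn-↑ʳ j c)

punchIn-↑ˡ : ∀ {a d} (j : Fin (suc a)) (c : Fin a) → punchIn (j ↑ˡ d) (c ↑ˡ d) ≡ punchIn j c ↑ˡ d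
punchIn-↑ˡ zero c = refl
punchIn-↑ˡ (suc j) zero = refl
punchIn-↑ˡ (suc j) (suc c) = cong suc (punchIn-↑ˡ j c)

det-block-lower-triangular : ∀ a d (A : Matrix (a ℕ.+ d)) → (∀ i j → A (i ↑ˡ d) (a ↑ʳ j) ≡ + 0) →
  det A ≡ det (λ i j → A (i ↑ˡ d) (j ↑ˡ d)) * det (λ i j → A (a ↑ʳ i) (a ↑ʳ j))
det-block-lower-triangular zero d A _ = sym (ℤₚ.*-identityˡ _)
det-block-lower-triangular (suc a) d A upper≡0 = begin
  altSum f                                                          ≡⟨ altSum-++ (suc a) d f ⟩
  altSum (λ j → f (j ↑ˡ d)) + sign (suc a) * altSum (λ j → f (suc a ↑ʳ j))
    ≡⟨ cong (λ t → altSum (λ j → f (j ↑ˡ d)) + sign (suc a) * t)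
         (altSum-zero (λ j → cong (_* det (minor A (suc a ↑ʳ j))) (upper≡0 zero j))) ⟩
  altSum (λ j → f (j ↑ˡ d)) + sign (suc a) * + 0                   ≡⟨ cong (_+_ (altSum (λ j → f (j ↑ˡ d)))) (ℤₚ.*-zeroʳ (sign (suc a))) ⟩
  altSum (λ j → f (j ↑ˡ d)) + + 0                                   ≡⟨ ℤₚ.+-identityʳ _ ⟩
  altSum (λ j → f (j ↑ˡ d))                                         ≡⟨ altSum-cong term ⟩
  altSum (λ j → det BR * (TL zero j * det (minor TL j)))            ≡⟨ altSum-* (det BR) (λ j → TL zero j * det (minor TL j)) ⟩
  det BR * det TL                                                   ≡⟨ ℤₚ.*-comm (det BR) (det TL) ⟩
  det TL * det BR                                                   ∎
  where
  open ≡-Reasoning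
  f : Fin (suc a ℕ.+ d) → ℤ
  f j = A zero j * det (minor A j)
  TL : Matrix (suc a)
  TL i j = A (i ↑ˡ d) (j ↑ˡ d)
  BR : Matrix d
  BR i j = A (suc a ↑ʳ i) (suc a ↑ʳ j)
  rotate : ∀ x y z → x * (y * z) ≡ z * (x * y)
  rotate = solve-∀
  term : ∀ j → f (j ↑ˡ d) ≡ det BR * (TL zero j * det (minor TL j))
  term j =
    trans (cong (A zero (j ↑ˡ d) *_)
      (trans (det-block-lower-triangular a d (minor A (j ↑ˡ d)) (λ i c → trans (cong (A (suc (i ↑ˡ d))) (punchIn-↑ʳ j c)) (upper≡0 (suc i) c)))
         (cong₂ _*_ (det-cong (λ r c → cong (A (suc (r ↑ˡ d))) (punchIn-↑ˡ j c)))
                    (det-cong (λ r c → cong (A (suc (a ↑ʳ r))) (punchIn-↑ʳ j c))))))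
    (rotate (TL zero j) (det (minor TL j)) (det BR))

-- Deleting column punchIn s j moves column s to index  shiftedIndex s j,  and
-- shiftSign s j = (-1)^(punchIn s j - j) is the sign change of the term for column punchIn s j.
shiftedIndex : ∀ {m} (s : Fin (suc (suc m))) (j : Fin (suc m)) → Fin (suc m)
shiftedIndex zero j = zero
shiftedIndex (suc s) zero = s
shiftedIndex {suc m} (suc s) (suc j) = suc (shiftedIndex s j)

shiftSign : ∀ {m} (s : Fin (suc (suc m))) (j : Fin (suc m)) → ℤ
shiftSign zero j = -1ℤ
shiftSign (suc s) zero = + 1
shiftSign {suc m} (suc s) (suc j) = shiftSign s j

punchIn-shiftedIndex : ∀ {m} (s : Fin (suc (suc m))) (j : Fin (suc m)) → punchIn (punchIn s j) (shiftedIndex s j) ≡ s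
punchIn-shiftedIndex zero j = refl
punchIn-shiftedIndex (suc s) zero = refl
punchIn-shiftedIndex {suc m} (suc s) (suc j) = cong suc (punchIn-shiftedIndex s j)

punchIn-punchIn-shiftedIndex : ∀ {m} (s : Fin (suc (suc m))) (j : Fin (suc m)) (c : Fin m) →
  punchIn (punchIn s j) (punchIn (shiftedIndex s j) c) ≡ punchIn s (punchIn j c)
punchIn-punchIn-shiftedIndex zero j c = refl
punchIn-punchIn-shiftedIndex (suc s) zero c = refl
punchIn-punchIn-shiftedIndex {suc m} (suc s) (suc j) zero = refl
punchIn-punchIn-shiftedIndex {suc m} (suc s) (suc j) (suc c) = cong suc (punchIn-punchIn-shiftedIndex s j c)

shiftSign-sign : ∀ {m} (s : Fin (suc (suc m))) (j : Fin (suc m)) →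
  shiftSign s j * sign (toℕ (shiftedIndex s j)) ≡ - sign (toℕ s)
shiftSign-sign zero j = refl
shiftSign-sign (suc s) zero = negate-twice (sign (toℕ s))
  where
  negate-twice : ∀ a → + 1 * a ≡ - (- (+ 1) * a)
  negate-twice = solve-∀
shiftSign-sign {suc m} (suc s) (suc j) =
  trans (pull (shiftSign s j) (sign (toℕ (shiftedIndex s j)))) (cong -_ (trans (shiftSign-sign s j) (sym (ℤₚ.-1*i≡-i (sign (toℕ s))))))
  where
  pull : ∀ a b → a * (- (+ 1) * b) ≡ - (a * b)
  pull = solve-∀

altSum-skip : ∀ {m} (s : Fin (suc (suc m))) (f : Fin (suc (suc m)) → ℤ) → f s ≡ + 0 →
  altSum f ≡ altSum (λ j → shiftSign s j * f (punchIn s j))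
altSum-skip zero f f₀≡0 =
  trans (cong (λ t → t - altSum (f ∘ suc)) f₀≡0)
    (trans (ℤₚ.+-identityˡ _) (trans (sym (ℤₚ.-1*i≡-i _)) (sym (altSum-* -1ℤ (f ∘ suc)))))
altSum-skip {zero} (suc zero) f f₁≡0 =
  trans (cong (λ t → f zero - (t - + 0)) f₁≡0) (cong (_- + 0) (sym (ℤₚ.*-identityˡ (f zero))))
altSum-skip {suc m} (suc s) f fs≡0 =
  cong₂ _-_ (sym (ℤₚ.*-identityˡ (f zero))) (altSum-skip s (f ∘ suc) fs≡0)

det-row-single : ∀ {m} (r s : Fin (suc m)) (A : Matrix (suc m)) → (∀ j → j ≢ s → A r j ≡ + 0) →
  det A ≡ sign (toℕ r ℕ.+ toℕ s) * A r s * det (λ i j → A (punchIn r i) (punchIn s j))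
det-row-single zero s A row≡0 =
  trans (altSum-single s (λ j → A zero j * det (minor A j)) (λ j j≢s → cong (_* det (minor A j)) (row≡0 j j≢s)))
    (sym (ℤₚ.*-assoc (sign (toℕ s)) (A zero s) _))
det-row-single {suc m} (suc q) s A row≡0 = begin
  altSum f                                             ≡⟨ altSum-skip s f fs≡0 ⟩
  altSum (λ j → shiftSign s j * f (punchIn s j))       ≡⟨ altSum-cong term ⟩
  altSum (λ j → K * (A zero (punchIn s j) * M j))      ≡⟨ altSum-* K (λ j → A zero (punchIn s j) * M j) ⟩
  K * det (λ i j → A (punchIn (suc q) i) (punchIn s j)) ∎
  where
  open ≡-Reasoning
  f : Fin (suc (suc m)) → ℤ
  f j = A zero j * det (minor A j)
  K = sign (toℕ (suc q) ℕ.+ toℕ s) * A (suc q) s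
  M : Fin (suc m) → ℤ
  M j = det (λ i c → A (suc (punchIn q i)) (punchIn s (punchIn j c)))
  fs≡0 : f s ≡ + 0
  fs≡0 = trans (cong (A zero s *_) (det-zero-row q (minor A s) (λ c → row≡0 _ (Finₚ.punchInᵢ≢i s c)))) (ℤₚ.*-zeroʳ (A zero s))
  term : ∀ j → shiftSign s j * f (punchIn s j) ≡ K * (A zero (punchIn s j) * M j)
  term j = begin
    ε * (a * det (minor A (punchIn s j)))
      ≡⟨ cong (λ t → ε * (a * t)) (det-row-single q o (minor A (punchIn s j))
           (λ c c≢o → row≡0 _ (λ eq → c≢o (Finₚ.punchIn-injective (punchIn s j) c o (trans eq (sym (punchIn-shiftedIndex s j))))))) ⟩
    ε * (a * (sign (toℕ q ℕ.+ toℕ o) * A (suc q) (punchIn (punchIn s j) o)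
                 * det (λ i c → A (suc (punchIn q i)) (punchIn (punchIn s j) (punchIn o c)))))
      ≡⟨ cong₂ (λ u t → ε * (a * (sign (toℕ q ℕ.+ toℕ o) * A (suc q) u * t)))
           (punchIn-shiftedIndex s j) (det-cong (λ i c → cong (A (suc (punchIn q i))) (punchIn-punchIn-shiftedIndex s j c))) ⟩
    ε * (a * (sign (toℕ q ℕ.+ toℕ o) * A (suc q) s * M j))
      ≡⟨ cong (λ t → ε * (a * (t * A (suc q) s * M j))) (sign-+ (toℕ q) (toℕ o)) ⟩
    ε * (a * (sign (toℕ q) * sign (toℕ o) * A (suc q) s * M j))
      ≡⟨ regroup ε a (sign (toℕ q)) (sign (toℕ o)) (A (suc q) s) (M j) ⟩
    - (sign (toℕ q)) * (ε * sign (toℕ o)) * A (suc q) s * (a * M j) * - + 1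
      ≡⟨ cong (λ t → - (sign (toℕ q)) * t * A (suc q) s * (a * M j) * - + 1) (shiftSign-sign s j) ⟩
    - (sign (toℕ q)) * - sign (toℕ s) * A (suc q) s * (a * M j) * - + 1
      ≡⟨ regroup′ (sign (toℕ q)) (sign (toℕ s)) (A (suc q) s) (a * M j) ⟩
    - (sign (toℕ q) * sign (toℕ s)) * A (suc q) s * (a * M j)
      ≡⟨ cong (λ t → - t * A (suc q) s * (a * M j)) (sym (sign-+ (toℕ q) (toℕ s))) ⟩
    - sign (toℕ q ℕ.+ toℕ s) * A (suc q) s * (a * M j)
      ≡⟨ cong (λ t → t * A (suc q) s * (a * M j)) (sym (ℤₚ.-1*i≡-i (sign (toℕ q ℕ.+ toℕ s)))) ⟩
    K * (a * M j) ∎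
    where
    ε = shiftSign s j
    a = A zero (punchIn s j)
    o = shiftedIndex s j
    regroup : ∀ e a sq so x d → e * (a * (sq * so * x * d)) ≡ - sq * (e * so) * x * (a * d) * - + 1
    regroup = solve-∀
    regroup′ : ∀ sq ss x y → - sq * - ss * x * y * - + 1 ≡ - (sq * ss) * x * y
    regroup′ = solve-∀

det-subtract-next-row : ∀ {m} (p : Fin (suc m)) (A : Matrix (suc (suc m))) →
  det (updateAt A (inject₁ p) (λ row j → row j - A (suc p) j)) ≡ det A
det-subtract-next-row p A = sym (begin
  det A             ≡⟨ det-row-+ (inject₁ p) A B C (λ i j i≢p → sym (B-other i j i≢p)) (λ i j i≢p → sym (C-other i j i≢p)) row-split ⟩
  det B + det C     ≡⟨ cong (_+_ (det B)) (det-equal-adjacent-rows p C C-rows≡) ⟩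
  det B + + 0       ≡⟨ ℤₚ.+-identityʳ (det B) ⟩
  det B             ∎)
  where
  open ≡-Reasoning
  B = updateAt A (inject₁ p) (λ row j → row j - A (suc p) j)
  C = updateAt A (inject₁ p) (λ _ → A (suc p))
  B-other : ∀ i j → i ≢ inject₁ p → B i j ≡ A i j
  B-other i j i≢p = cong-app (updateAt-minimal i (inject₁ p) A i≢p) j
  C-other : ∀ i j → i ≢ inject₁ p → C i j ≡ A i j
  C-other i j i≢p = cong-app (updateAt-minimal i (inject₁ p) A i≢p) j
  split : ∀ a b → a ≡ (a - b) + b
  split = solve-∀
  row-split : ∀ j → A (inject₁ p) j ≡ B (inject₁ p) j + C (inject₁ p) j
  row-split j = trans (split (A (inject₁ p) j) (A (suc p) j))
    (sym (cong₂ _+_ (cong-app (updateAt-updates (inject₁ p) A) j) (cong-app (updateAt-updates (inject₁ p) A) j)))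
  C-rows≡ : ∀ j → C (inject₁ p) j ≡ C (suc p) j
  C-rows≡ j = trans (cong-app (updateAt-updates (inject₁ p) A) j) (sym (C-other (suc p) j (inject₁≢suc p ∘ sym)))

det-add-previous-col : ∀ {m} (p : Fin (suc m)) (A : Matrix (suc (suc m))) →
  det (λ i → updateAt (A i) (suc p) (_+ A i (inject₁ p))) ≡ det A
det-add-previous-col p A = begin
  det B             ≡⟨ det-col-+ (suc p) B A C B-other (λ i j j≢p → trans (B-other i j j≢p) (sym (C-other i j j≢p))) col-split ⟩
  det A + det C     ≡⟨ cong (_+_ (det A)) (det-equal-adjacent-cols p C C-cols≡) ⟩
  det A + + 0       ≡⟨ ℤₚ.+-identityʳ (det A) ⟩
  det A             ∎
  where
  open ≡-Reasoning
  B : Matrix _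
  B i = updateAt (A i) (suc p) (_+ A i (inject₁ p))
  C : Matrix _
  C i = updateAt (A i) (suc p) (λ _ → A i (inject₁ p))
  B-other : ∀ i j → j ≢ suc p → B i j ≡ A i j
  B-other i j j≢p = updateAt-minimal j (suc p) (A i) j≢p
  C-other : ∀ i j → j ≢ suc p → C i j ≡ A i j
  C-other i j j≢p = updateAt-minimal j (suc p) (A i) j≢p
  col-split : ∀ i → B i (suc p) ≡ A i (suc p) + C i (suc p)
  col-split i = trans (updateAt-updates (suc p) (A i)) (cong (_+_ (A i (suc p))) (sym (updateAt-updates (suc p) (A i))))
  C-cols≡ : ∀ i → C i (inject₁ p) ≡ C i (suc p)
  C-cols≡ i = trans (C-other i (inject₁ p) (inject₁≢suc p)) (sym (updateAt-updates (suc p) (A i)))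

det-cast : ∀ {a b} (eq : a ≡ b) (A : Matrix b) → det (λ i j → A (cast eq i) (cast eq j)) ≡ det A
det-cast refl A = det-cong (λ i j → cong₂ A (Finₚ.cast-is-id refl i) (Finₚ.cast-is-id refl j))

cast-injective : ∀ {a b} (eq : a ≡ b) (i j : Fin a) → cast eq i ≡ cast eq j → i ≡ j
cast-injective eq i j cast≡ = Finₚ.toℕ-injective (trans (sym (Finₚ.toℕ-cast eq i)) (trans (cong toℕ cast≡) (Finₚ.toℕ-cast eq j)))

lookup-++ˡ : ∀ {A : Set} (xs ys : List A) (i : Fin (length xs)) →
  lookup (xs ++ ys) (cast (sym (Listₚ.length-++ xs)) (i ↑ˡ length ys)) ≡ lookup xs i
lookup-++ˡ (x ∷ xs) ys zero = refl
lookup-++ˡ (x ∷ xs) ys (suc i) = lookup-++ˡ xs ys i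

lookup-++ʳ : ∀ {A : Set} (xs ys : List A) (j : Fin (length ys)) →
  lookup (xs ++ ys) (cast (sym (Listₚ.length-++ xs)) (length xs ↑ʳ j)) ≡ lookup ys j
lookup-++ʳ [] ys j = cong (lookup ys) (Finₚ.cast-is-id refl j)
lookup-++ʳ (x ∷ xs) ys j = lookup-++ʳ xs ys j

↑ˡ≢↑ʳ : ∀ {a b} (i : Fin a) (j : Fin b) → i ↑ˡ b ≢ a ↑ʳ j
↑ˡ≢↑ʳ {a} {b} i j eq = ℕₚ.<-irrefl toℕ≡ (ℕₚ.<-≤-trans (Finₚ.toℕ<n i) (ℕₚ.m≤m+n a (toℕ j)))
  where
  toℕ≡ : toℕ i ≡ a ℕ.+ toℕ j
  toℕ≡ = trans (sym (Finₚ.toℕ-↑ˡ i b)) (trans (cong toℕ eq) (Finₚ.toℕ-↑ʳ a j))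

-- Matrices whose entries depend only on labels of the rows and columns

module LabelledMatrix {V : Set} (D : V → ℤ) (E : V → V → ℤ) where

  mat : ∀ {n} → (Fin n → V) → Matrix n
  mat f i j = if ⌊ i Fin.≟ j ⌋ then D (f i) else E (f i) (f j)

  mat-diag : ∀ {n} (f : Fin n → V) i → mat f i i ≡ D (f i)
  mat-diag f i with i Fin.≟ i
  ... | yes _   = refl
  ... | no i≢i = ⊥-elim (i≢i refl)

  mat-off : ∀ {n} (f : Fin n → V) i j → i ≢ j → mat f i j ≡ E (f i) (f j)
  mat-off f i j i≢j with i Fin.≟ j
  ... | yes i≡j = ⊥-elim (i≢j i≡j)
  ... | no _    = refl

  mat-reindex : ∀ {a b} (σ : Fin a → Fin b) → (∀ i j → σ i ≡ σ j → i ≡ j) →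
    (f : Fin b → V) (g : Fin a → V) → (∀ i → f (σ i) ≡ g i) → ∀ i j → mat f (σ i) (σ j) ≡ mat g i j
  mat-reindex σ σ-inj f g f∘σ≗g i j with i Fin.≟ j
  ... | yes refl = trans (mat-diag f (σ i)) (cong D (f∘σ≗g i))
  ... | no i≢j   = trans (mat-off f (σ i) (σ j) (i≢j ∘ σ-inj i j)) (cong₂ E (f∘σ≗g i) (f∘σ≗g j))

  -- seen from the label z, the label w behaves like v in its row and like u + v in its column
  Mergeable : V → V → V → V → Set
  Mergeable u v w z = E u z ≡ E v z × E w z ≡ E v z × E z w ≡ E z u + E z v

  -- Subtracting row p+1
  -- from row p and then adding column p to column p+1 leaves c as the only nonzero entry of
  -- row p; what remains after deleting row and column p is the matrix of the merged labels g.
  det-merge : ∀ {n} (f : Fin (suc (suc n)) → V) (p : Fin (suc n)) (w : V) (c : ℤ) →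
    let u = f (inject₁ p); v = f (suc p) in
    (∀ k → k ≢ inject₁ p → k ≢ suc p → Mergeable u v w (f k)) →
    D u - E v u ≡ c → E u v - D v ≡ - c → D w ≡ D v + E v u →
    (g : Fin (suc n) → V) → g p ≡ w → (∀ i → i ≢ p → g i ≡ f (punchIn (inject₁ p) i)) →
    det (mat f) ≡ c * det (mat g)
  det-merge {n} f p w c mergeable diag-u diag-v diag-w g g-p g-other = begin
    det A                                                          ≡⟨ sym (det-subtract-next-row p A) ⟩
    det B                                                          ≡⟨ sym (det-add-previous-col p B) ⟩
    det C                                                          ≡⟨ det-row-single p₀ p₀ C C-row ⟩
    sign (toℕ p₀ ℕ.+ toℕ p₀) * C p₀ p₀ * det (λ i j → C (punchIn p₀ i) (punchIn p₀ j))
      ≡⟨ cong₂ (λ s t → s * t * det (λ i j → C (punchIn p₀ i) (punchIn p₀ j))) (sign-double (toℕ p₀)) C-pivot ⟩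
    + 1 * c * det (λ i j → C (punchIn p₀ i) (punchIn p₀ j))       ≡⟨ cong₂ _*_ (ℤₚ.*-identityˡ c) (det-cong C-minor) ⟩
    c * det (mat g)                                                ∎
    where
    open ≡-Reasoning
    p₀ = inject₁ p
    p₁ = suc p
    u = f p₀
    v = f p₁
    A = mat f
    B = updateAt A p₀ (λ row j → row j - A p₁ j)
    C : Matrix (suc (suc n))
    C i = updateAt (B i) p₁ (_+ B i p₀)
    p₀≢p₁ = inject₁≢suc p
    p₁≢p₀ : p₁ ≢ p₀
    p₁≢p₀ = p₀≢p₁ ∘ sym
    B-row : ∀ j → B p₀ j ≡ A p₀ j - A p₁ j
    B-row j = cong-app (updateAt-updates p₀ A) j
    B-other : ∀ i j → i ≢ p₀ → B i j ≡ A i j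
    B-other i j i≢p₀ = cong-app (updateAt-minimal i p₀ A i≢p₀) j
    C-col : ∀ i → C i p₁ ≡ B i p₁ + B i p₀
    C-col i = updateAt-updates p₁ (B i)
    C-other : ∀ i j → j ≢ p₁ → C i j ≡ B i j
    C-other i j j≢p₁ = updateAt-minimal j p₁ (B i) j≢p₁
    B-pivot : B p₀ p₀ ≡ c
    B-pivot = trans (B-row p₀) (trans (cong₂ _-_ (mat-diag f p₀) (mat-off f p₁ p₀ p₁≢p₀)) diag-u)
    C-pivot : C p₀ p₀ ≡ c
    C-pivot = trans (C-other p₀ p₀ p₀≢p₁) B-pivot
    C-row : ∀ j → j ≢ p₀ → C p₀ j ≡ + 0
    C-row j j≢p₀ with j Fin.≟ p₁
    ... | yes refl = trans (C-col p₀)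
            (trans (cong₂ _+_ (trans (B-row p₁) (cong₂ _-_ (mat-off f p₀ p₁ p₀≢p₁) (mat-diag f p₁))) B-pivot)
              (trans (cong (_+ c) diag-v) (ℤₚ.+-inverseˡ c)))
    ... | no j≢p₁ = trans (C-other p₀ j j≢p₁)
            (trans (B-row j) (trans (cong₂ _-_ (mat-off f p₀ j (j≢p₀ ∘ sym)) (mat-off f p₁ j (j≢p₁ ∘ sym)))
              (trans (cong (_- E v (f j)) (proj₁ (mergeable j j≢p₀ j≢p₁))) (ℤₚ.+-inverseʳ (E v (f j))))))
    punchIn≢p₀ : ∀ i → punchIn p₀ i ≢ p₀
    punchIn≢p₀ = Finₚ.punchInᵢ≢i p₀
    punchIn≢p₁ : ∀ i → i ≢ p → punchIn p₀ i ≢ p₁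
    punchIn≢p₁ i i≢p eq = i≢p (Finₚ.punchIn-injective p₀ i p (trans eq (sym (punchIn-inject₁ p))))
    C-minor : ∀ i j → C (punchIn p₀ i) (punchIn p₀ j) ≡ mat g i j
    C-minor i j with j Fin.≟ p | i Fin.≟ p
    ... | yes refl | yes refl = begin
      C (punchIn p₀ p) (punchIn p₀ p)     ≡⟨ cong₂ C (punchIn-inject₁ p) (punchIn-inject₁ p) ⟩
      C p₁ p₁                             ≡⟨ C-col p₁ ⟩
      B p₁ p₁ + B p₁ p₀                   ≡⟨ cong₂ _+_ (B-other p₁ p₁ p₁≢p₀) (B-other p₁ p₀ p₁≢p₀) ⟩
      A p₁ p₁ + A p₁ p₀                   ≡⟨ cong₂ _+_ (mat-diag f p₁) (mat-off f p₁ p₀ p₁≢p₀) ⟩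
      D v + E v u                         ≡⟨ sym diag-w ⟩
      D w                                 ≡⟨ cong D (sym g-p) ⟩
      D (g p)                             ≡⟨ sym (mat-diag g p) ⟩
      mat g p p                           ∎
    ... | yes refl | no i≢p = begin
      C (punchIn p₀ i) (punchIn p₀ p)     ≡⟨ cong (C (punchIn p₀ i)) (punchIn-inject₁ p) ⟩
      C (punchIn p₀ i) p₁                 ≡⟨ C-col (punchIn p₀ i) ⟩
      B (punchIn p₀ i) p₁ + B (punchIn p₀ i) p₀
        ≡⟨ cong₂ _+_ (B-other _ p₁ (punchIn≢p₀ i)) (B-other _ p₀ (punchIn≢p₀ i)) ⟩
      A (punchIn p₀ i) p₁ + A (punchIn p₀ i) p₀
        ≡⟨ cong₂ _+_ (mat-off f _ p₁ (punchIn≢p₁ i i≢p)) (mat-off f _ p₀ (punchIn≢p₀ i)) ⟩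
      E (f (punchIn p₀ i)) v + E (f (punchIn p₀ i)) u
        ≡⟨ ℤₚ.+-comm (E (f (punchIn p₀ i)) v) (E (f (punchIn p₀ i)) u) ⟩
      E (f (punchIn p₀ i)) u + E (f (punchIn p₀ i)) v
        ≡⟨ sym (proj₂ (proj₂ (mergeable (punchIn p₀ i) (punchIn≢p₀ i) (punchIn≢p₁ i i≢p)))) ⟩
      E (f (punchIn p₀ i)) w              ≡⟨ cong₂ E (sym (g-other i i≢p)) (sym g-p) ⟩
      E (g i) (g p)                       ≡⟨ sym (mat-off g i p i≢p) ⟩
      mat g i p                           ∎
    ... | no j≢p | yes refl = begin
      C (punchIn p₀ p) (punchIn p₀ j)     ≡⟨ cong (λ k → C k (punchIn p₀ j)) (punchIn-inject₁ p) ⟩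
      C p₁ (punchIn p₀ j)                 ≡⟨ C-other p₁ _ (punchIn≢p₁ j j≢p) ⟩
      B p₁ (punchIn p₀ j)                 ≡⟨ B-other p₁ _ p₁≢p₀ ⟩
      A p₁ (punchIn p₀ j)                 ≡⟨ mat-off f p₁ _ (punchIn≢p₁ j j≢p ∘ sym) ⟩
      E v (f (punchIn p₀ j))              ≡⟨ sym (proj₁ (proj₂ (mergeable (punchIn p₀ j) (punchIn≢p₀ j) (punchIn≢p₁ j j≢p)))) ⟩
      E w (f (punchIn p₀ j))              ≡⟨ cong₂ E (sym g-p) (sym (g-other j j≢p)) ⟩
      E (g p) (g j)                       ≡⟨ sym (mat-off g p j (j≢p ∘ sym)) ⟩
      mat g p j                           ∎
    ... | no j≢p | no i≢p =
      trans (C-other _ _ (punchIn≢p₁ j j≢p))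
        (trans (B-other _ _ (punchIn≢p₀ i))
          (trans (mat-reindex (punchIn p₀) (Finₚ.punchIn-injective p₀) f (f ∘ punchIn p₀) (λ _ → refl) i j)
            (kept i≢p j≢p)))
      where
      kept : i ≢ p → j ≢ p → mat (f ∘ punchIn p₀) i j ≡ mat g i j
      kept i≢p j≢p with i Fin.≟ j
      ... | yes refl = cong D (sym (g-other i i≢p))
      ... | no _     = cong₂ E (sym (g-other i i≢p)) (sym (g-other j j≢p))

  detL : List V → ℤ
  detL L = det (mat (lookup L))

  detL-reindex : ∀ {a} (L : List V) (eq : a ≡ length L) (g : Fin a → V) →
    (∀ i → lookup L (cast eq i) ≡ g i) → detL L ≡ det (mat g)
  detL-reindex L eq g lookup≗g = trans (sym (det-cast eq (mat (lookup L))))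
    (det-cong (mat-reindex (cast eq) (cast-injective eq) (lookup L) g lookup≗g))

  detL-tabulate : ∀ {n} (g : Fin n → V) → detL (tabulate g) ≡ det (mat g)
  detL-tabulate g = detL-reindex (tabulate g) (sym (Listₚ.length-tabulate g)) g (Listₚ.lookup-tabulate g)

  detL-[_] : ∀ x → detL (x ∷ []) ≡ D x
  detL-[ x ] = trans (ℤₚ.+-identityʳ _) (trans (ℤₚ.*-identityʳ _) (mat-diag (lookup (x ∷ [])) zero))

  Decoupled : List V → List V → Set
  Decoupled xs ys = All (λ a → All (λ b → E a b ≡ + 0) ys) xs

  detL-++ : ∀ xs ys → Decoupled xs ys → detL (xs ++ ys) ≡ detL xs * detL ys
  detL-++ xs ys decoupled =
    trans (detL-reindex (xs ++ ys) eq f (λ _ → refl))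
      (trans (det-block-lower-triangular a b (mat f) upper≡0)
        (cong₂ _*_ (det-cong (mat-reindex (_↑ˡ b) (Finₚ.↑ˡ-injective b) f (lookup xs) (lookup-++ˡ xs ys)))
                   (det-cong (mat-reindex (a ↑ʳ_) (Finₚ.↑ʳ-injective a) f (lookup ys) (lookup-++ʳ xs ys)))))
    where
    a = length xs
    b = length ys
    eq = sym (Listₚ.length-++ xs)
    f : Fin (a ℕ.+ b) → V
    f i = lookup (xs ++ ys) (cast eq i)
    upper≡0 : ∀ i j → mat f (i ↑ˡ b) (a ↑ʳ j) ≡ + 0
    upper≡0 i j = trans (mat-off f (i ↑ˡ b) (a ↑ʳ j) (↑ˡ≢↑ʳ i j))
      (trans (cong₂ E (lookup-++ˡ xs ys i) (lookup-++ʳ xs ys j))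
        (All.lookup (All.lookup decoupled (∈-lookup i)) (∈-lookup j)))

  detL-concat : ∀ {n} (g : Fin n → List V) → (∀ k k′ → k Fin.< k′ → Decoupled (g k) (g k′)) →
    detL (concat (tabulate g)) ≡ ∏ (detL ∘ g)
  detL-concat {zero}  g decoupled = refl
  detL-concat {suc n} g decoupled =
    trans (detL-++ (g zero) (concat (tabulate (g ∘ suc)))
            (All.tabulate (λ a∈ → concat⁺ (tabulate⁺ (λ k → All.lookup (decoupled zero (suc k) (s≤s z≤n)) a∈)))))
      (cong (detL (g zero) *_) (detL-concat (g ∘ suc) (λ k k′ k<k′ → decoupled (suc k) (suc k′) (s≤s k<k′))))

  detL-merge₀ : ∀ u v w rest c → All (Mergeable u v w) rest →
    D u - E v u ≡ c → E u v - D v ≡ - c → D w ≡ D v + E v u →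
    detL (u ∷ v ∷ rest) ≡ c * detL (w ∷ rest)
  detL-merge₀ u v w rest c mergeable diag-u diag-v diag-w =
    det-merge (lookup (u ∷ v ∷ rest)) zero w c
      (λ { zero 0≢0 _ → ⊥-elim (0≢0 refl) ; (suc zero) _ 1≢1 → ⊥-elim (1≢1 refl)
         ; (suc (suc k)) _ _ → All.lookup mergeable (∈-lookup k) })
      diag-u diag-v diag-w (lookup (w ∷ rest)) refl
      (λ { zero 0≢0 → ⊥-elim (0≢0 refl) ; (suc i) _ → refl })

  detL-merge₁ : ∀ x u v w rest c → Mergeable u v w x → All (Mergeable u v w) rest →
    D u - E v u ≡ c → E u v - D v ≡ - c → D w ≡ D v + E v u →
    detL (x ∷ u ∷ v ∷ rest) ≡ c * detL (x ∷ w ∷ rest)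
  detL-merge₁ x u v w rest c mergeable-x mergeable diag-u diag-v diag-w =
    det-merge (lookup (x ∷ u ∷ v ∷ rest)) (suc zero) w c
      (λ { zero _ _ → mergeable-x ; (suc zero) 1≢1 _ → ⊥-elim (1≢1 refl) ; (suc (suc zero)) _ 2≢2 → ⊥-elim (2≢2 refl)
         ; (suc (suc (suc k))) _ _ → All.lookup mergeable (∈-lookup k) })
      diag-u diag-v diag-w (lookup (x ∷ w ∷ rest)) refl
      (λ { zero _ → refl ; (suc zero) 1≢1 → ⊥-elim (1≢1 refl) ; (suc (suc i)) _ → refl })

-- The complete multipartite part

productℤ : List ℤ → ℤ
productℤ = foldr _*_ (+ 1)

-- A cluster stands for  size  vertices of the block  block  that have been merged; each
-- diagonal entry is  diag, and distinct blocks are coupled with weight -1 per vertex.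
record Cluster : Set where
  constructor cluster
  field
    block : ℕ
    size  : ℤ
    diag  : ℤ
open Cluster

coupling : Cluster → Cluster → ℤ
coupling u v = if block u ℕ.≡ᵇ block v then + 0 else - size v

open LabelledMatrix diag coupling

coupling-distinct : ∀ u v → block u ≢ block v → coupling u v ≡ - size v
coupling-distinct u v u≢v with block u ℕ.≡ᵇ block v in u≡ᵇv
... | true  = ⊥-elim (u≢v (ℕₚ.≡ᵇ⇒≡ (block u) (block v) (Equivalence.from T-≡ u≡ᵇv)))
... | false = refl

coupling-same : ∀ u v → block u ≡ block v → coupling u v ≡ + 0
coupling-same u v u≡v with block u ℕ.≡ᵇ block v in u≡ᵇv
... | true  = refl
... | false = ⊥-elim (subst T u≡ᵇv (ℕₚ.≡⇒≡ᵇ (block u) (block v) u≡v))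

module _ (β : ℕ) (a d : ℤ) where
  private
    u v w : Cluster
    u = cluster β a d
    v = cluster β (+ 1) d
    w = cluster β (a + + 1) d

  mergeable-same-block : ∀ z → Mergeable u v w z
  mergeable-same-block z = refl , refl , column
    where
    column : coupling z w ≡ coupling z u + coupling z v
    column with block z ℕ.≡ᵇ β
    ... | true  = refl
    ... | false = ℤₚ.neg-distrib-+ a (+ 1)

  pivot-same-block : diag u - coupling v u ≡ d
  pivot-same-block = trans (cong (_-_ d) (coupling-same v u refl)) (ℤₚ.+-identityʳ d)

  pivot′-same-block : coupling u v - diag v ≡ - d
  pivot′-same-block = trans (cong (_- d) (coupling-same u v refl)) (ℤₚ.+-identityˡ (- d))

  diag-same-block : diag w ≡ diag v + coupling v u
  diag-same-block = sym (trans (cong (_+_ d) (coupling-same v u refl)) (ℤₚ.+-identityʳ d))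

  detL-absorb₀ : ∀ R → detL (u ∷ v ∷ R) ≡ d * detL (w ∷ R)
  detL-absorb₀ R = detL-merge₀ u v w R d (All.universal mergeable-same-block R)
    pivot-same-block pivot′-same-block diag-same-block

  detL-absorb₁ : ∀ x R → detL (x ∷ u ∷ v ∷ R) ≡ d * detL (x ∷ w ∷ R)
  detL-absorb₁ x R = detL-merge₁ x u v w R d (mergeable-same-block x) (All.universal mergeable-same-block R)
    pivot-same-block pivot′-same-block diag-same-block

detL-absorb-block₀ : ∀ n β a d R →
  detL (cluster β a d ∷ replicate n (cluster β (+ 1) d) ++ R) ≡ d ^ n * detL (cluster β (a + + n) d ∷ R)
detL-absorb-block₀ zero β a d R =
  sym (trans (ℤₚ.*-identityˡ _) (cong (λ s → detL (cluster β s d ∷ R)) (ℤₚ.+-identityʳ a)))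
detL-absorb-block₀ (suc n) β a d R = begin
  detL (cluster β a d ∷ cluster β (+ 1) d ∷ replicate n (cluster β (+ 1) d) ++ R)
    ≡⟨ detL-absorb₀ β a d (replicate n (cluster β (+ 1) d) ++ R) ⟩
  d * detL (cluster β (a + + 1) d ∷ replicate n (cluster β (+ 1) d) ++ R)
    ≡⟨ cong (d *_) (detL-absorb-block₀ n β (a + + 1) d R) ⟩
  d * (d ^ n * detL (cluster β (a + + 1 + + n) d ∷ R))
    ≡⟨ sym (ℤₚ.*-assoc d (d ^ n) _) ⟩
  d ^ suc n * detL (cluster β (a + + 1 + + n) d ∷ R)
    ≡⟨ cong (λ s → d ^ suc n * detL (cluster β s d ∷ R)) (ℤₚ.+-assoc a (+ 1) (+ n)) ⟩
  d ^ suc n * detL (cluster β (a + + suc n) d ∷ R) ∎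
  where open ≡-Reasoning

detL-absorb-block₁ : ∀ x n β a d R →
  detL (x ∷ cluster β a d ∷ replicate n (cluster β (+ 1) d) ++ R) ≡ d ^ n * detL (x ∷ cluster β (a + + n) d ∷ R)
detL-absorb-block₁ x zero β a d R =
  sym (trans (ℤₚ.*-identityˡ _) (cong (λ s → detL (x ∷ cluster β s d ∷ R)) (ℤₚ.+-identityʳ a)))
detL-absorb-block₁ x (suc n) β a d R = begin
  detL (x ∷ cluster β a d ∷ cluster β (+ 1) d ∷ replicate n (cluster β (+ 1) d) ++ R)
    ≡⟨ detL-absorb₁ β a d x (replicate n (cluster β (+ 1) d) ++ R) ⟩
  d * detL (x ∷ cluster β (a + + 1) d ∷ replicate n (cluster β (+ 1) d) ++ R)
    ≡⟨ cong (d *_) (detL-absorb-block₁ x n β (a + + 1) d R) ⟩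
  d * (d ^ n * detL (x ∷ cluster β (a + + 1 + + n) d ∷ R))
    ≡⟨ sym (ℤₚ.*-assoc d (d ^ n) _) ⟩
  d ^ suc n * detL (x ∷ cluster β (a + + 1 + + n) d ∷ R)
    ≡⟨ cong (λ s → d ^ suc n * detL (x ∷ cluster β s d ∷ R)) (ℤₚ.+-assoc a (+ 1) (+ n)) ⟩
  d ^ suc n * detL (x ∷ cluster β (a + + suc n) d ∷ R) ∎
  where open ≡-Reasoning

detL-merge-blocks : ∀ β₀ w₀ d₀ β w d R y → β₀ ≢ β → d₀ + w₀ ≡ y → d + w ≡ y →
  All (λ z → block z ≢ β₀ × block z ≢ β) R →
  detL (cluster β₀ w₀ d₀ ∷ cluster β w d ∷ R) ≡ y * detL (cluster β₀ (w₀ + w) (d - w₀) ∷ R)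
detL-merge-blocks β₀ w₀ d₀ β w d R y β₀≢β row₀ row R-elsewhere =
  detL-merge₀ u v m R y (All.map (λ {z} → mergeable {z}) R-elsewhere) pivot pivot′
    (cong (_+_ d) (sym (coupling-distinct v u (β₀≢β ∘ sym))))
  where
  u = cluster β₀ w₀ d₀
  v = cluster β w d
  m = cluster β₀ (w₀ + w) (d - w₀)
  mergeable : ∀ {z} → block z ≢ β₀ × block z ≢ β → Mergeable u v m z
  mergeable {z} (z≢β₀ , z≢β) =
    trans (coupling-distinct u z (z≢β₀ ∘ sym)) (sym (coupling-distinct v z (z≢β ∘ sym))) ,
    trans (coupling-distinct m z (z≢β₀ ∘ sym)) (sym (coupling-distinct v z (z≢β ∘ sym))) ,
    trans (coupling-distinct z m z≢β₀)
      (trans (ℤₚ.neg-distrib-+ w₀ w) (sym (cong₂ _+_ (coupling-distinct z u z≢β₀) (coupling-distinct z v z≢β))))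
  pivot : d₀ - coupling v u ≡ y
  pivot = trans (cong (_-_ d₀) (coupling-distinct v u (β₀≢β ∘ sym))) (trans (cong (_+_ d₀) (ℤₚ.neg-involutive w₀)) row₀)
  negate-sum : ∀ w d → - w - d ≡ - (d + w)
  negate-sum = solve-∀
  pivot′ : coupling u v - d ≡ - y
  pivot′ = trans (cong (_- d) (coupling-distinct u v β₀≢β)) (trans (negate-sum w d) (cong -_ row))

clusters : ℤ → ℕ → List ℕ → List Cluster
clusters y o []       = []
clusters y o (n ∷ ns) = replicate n (cluster o (+ 1) (y - + n)) ++ clusters y (suc o) ns

clusters-blocks : ∀ y o ns → All (λ z → o ≤ block z) (clusters y o ns)
clusters-blocks y o []       = []
clusters-blocks y o (n ∷ ns) = ++⁺ (replicate⁺ n ℕₚ.≤-refl)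
  (All.map (ℕₚ.≤-trans (ℕₚ.n≤1+n o)) (clusters-blocks y (suc o) ns))

detL-clusters-after : ∀ y ns o β₀ w₀ d₀ → β₀ < o → All (1 ≤_) ns → d₀ + w₀ ≡ y →
  detL (cluster β₀ w₀ d₀ ∷ clusters y o ns)
    ≡ y ^ length ns * (d₀ - + sum ns) * productℤ (map (λ n → (y - + n) ^ (n ∸ 1)) ns)
detL-clusters-after y [] o β₀ w₀ d₀ _ _ _ =
  trans detL-[ cluster β₀ w₀ d₀ ] (sym (trans (ℤₚ.*-identityʳ _) (trans (ℤₚ.*-identityˡ _) (ℤₚ.+-identityʳ d₀))))
detL-clusters-after y (suc n ∷ ns) o β₀ w₀ d₀ β₀<o (_ ∷ ns≥1) row₀ = begin
  detL (cluster β₀ w₀ d₀ ∷ cluster o (+ 1) d ∷ replicate n (cluster o (+ 1) d) ++ R)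
    ≡⟨ detL-absorb-block₁ (cluster β₀ w₀ d₀) n o (+ 1) d R ⟩
  d ^ n * detL (cluster β₀ w₀ d₀ ∷ cluster o (+ 1 + + n) d ∷ R)
    ≡⟨ cong (d ^ n *_) (detL-merge-blocks β₀ w₀ d₀ o (+ 1 + + n) d R y (ℕₚ.<⇒≢ β₀<o) row₀ row
         (All.map (λ o<z → (λ z≡β₀ → ℕₚ.<-irrefl (sym z≡β₀) (ℕₚ.<-≤-trans β₀<o (ℕₚ.≤-trans (ℕₚ.n≤1+n o) o<z))) ,
                           (λ z≡o → ℕₚ.<-irrefl (sym z≡o) o<z))
                  (clusters-blocks y (suc o) ns))) ⟩
  d ^ n * (y * detL (cluster β₀ (w₀ + (+ 1 + + n)) (d - w₀) ∷ R))
    ≡⟨ cong (λ t → d ^ n * (y * t)) (detL-clusters-after y ns (suc o) β₀ (w₀ + (+ 1 + + n)) (d - w₀) (ℕₚ.m<n⇒m<1+n β₀<o) ns≥1 row′) ⟩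
  d ^ n * (y * (y ^ length ns * (d - w₀ - + sum ns) * P))
    ≡⟨ cong (λ t → d ^ n * (t * (y ^ length ns * (t - + suc n - w₀ - + sum ns) * P))) (sym row₀) ⟩
  d ^ n * ((d₀ + w₀) * (y ^ length ns * ((d₀ + w₀) - + suc n - w₀ - + sum ns) * P))
    ≡⟨ regroup d₀ w₀ (+ suc n) (+ sum ns) (y ^ length ns) (d ^ n) P ⟩
  (d₀ + w₀) * y ^ length ns * (d₀ - (+ suc n + + sum ns)) * (d ^ n * P)
    ≡⟨ cong₂ (λ s t → s * y ^ length ns * (d₀ - t) * (d ^ n * P)) row₀ (sym (ℤₚ.pos-+ (suc n) (sum ns))) ⟩
  y ^ length (suc n ∷ ns) * (d₀ - + sum (suc n ∷ ns)) * productℤ (map (λ n → (y - + n) ^ (n ∸ 1)) (suc n ∷ ns)) ∎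
  where
  open ≡-Reasoning
  d = y - + suc n
  R = clusters y (suc o) ns
  P = productℤ (map (λ n → (y - + n) ^ (n ∸ 1)) ns)
  cancel : ∀ y s → y - s + s ≡ y
  cancel = solve-∀
  row : d + (+ 1 + + n) ≡ y
  row = cancel y (+ suc n)
  shift : ∀ d w s → d - w + (w + s) ≡ d + s
  shift = solve-∀
  row′ : d - w₀ + (w₀ + (+ 1 + + n)) ≡ y
  row′ = trans (shift d w₀ (+ 1 + + n)) row
  regroup : ∀ d₀ w₀ sn S Y dn P →
    dn * ((d₀ + w₀) * (Y * ((d₀ + w₀) - sn - w₀ - S) * P)) ≡ (d₀ + w₀) * Y * (d₀ - (sn + S)) * (dn * P)
  regroup = solve-∀

detL-clusters : ∀ y ns → All (1 ≤_) ns → 1 ≤ length ns →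
  detL (clusters y 0 ns) ≡ y ^ (length ns ∸ 1) * (y - + sum ns) * productℤ (map (λ n → (y - + n) ^ (n ∸ 1)) ns)
detL-clusters y (suc n ∷ ns) (_ ∷ ns≥1) _ = begin
  detL (cluster 0 (+ 1) d ∷ replicate n (cluster 0 (+ 1) d) ++ R)
    ≡⟨ detL-absorb-block₀ n 0 (+ 1) d R ⟩
  d ^ n * detL (cluster 0 (+ 1 + + n) d ∷ R)
    ≡⟨ cong (d ^ n *_) (detL-clusters-after y ns 1 0 (+ 1 + + n) d (s≤s z≤n) ns≥1 (cancel y (+ suc n))) ⟩
  d ^ n * (y ^ length ns * (d - + sum ns) * P)
    ≡⟨ regroup y (+ suc n) (+ sum ns) (y ^ length ns) (d ^ n) P ⟩
  y ^ length ns * (y - (+ suc n + + sum ns)) * (d ^ n * P)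
    ≡⟨ cong (λ t → y ^ length ns * (y - t) * (d ^ n * P)) (sym (ℤₚ.pos-+ (suc n) (sum ns))) ⟩
  y ^ length ns * (y - + sum (suc n ∷ ns)) * (d ^ n * P) ∎
  where
  open ≡-Reasoning
  d = y - + suc n
  R = clusters y 1 ns
  P = productℤ (map (λ n → (y - + n) ^ (n ∸ 1)) ns)
  cancel : ∀ y s → y - s + s ≡ y
  cancel = solve-∀
  regroup : ∀ y sn S Y dn P → dn * (Y * (y - sn - S) * P) ≡ Y * (y - (sn + S)) * (dn * P)
  regroup = solve-∀

blockSize : List ℕ → ℕ → ℕ
blockSize []       β       = 0
blockSize (n ∷ ns) zero    = n
blockSize (n ∷ ns) (suc β) = blockSize ns β

blockOf-↑ˡ : ∀ n ns (k : Fin n) → blockOf (n ∷ ns) (toℕ (k ↑ˡ sum ns)) ≡ 0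
blockOf-↑ˡ n ns k rewrite Finₚ.toℕ-↑ˡ k (sum ns) | Equivalence.to T-≡ (ℕₚ.<⇒<ᵇ (Finₚ.toℕ<n k)) = refl

blockOf-↑ʳ : ∀ n ns (u : Fin (sum ns)) → blockOf (n ∷ ns) (toℕ (n ↑ʳ u)) ≡ suc (blockOf ns (toℕ u))
blockOf-↑ʳ n ns u rewrite Finₚ.toℕ-↑ʳ n u with (n ℕ.+ toℕ u) ℕ.<ᵇ n in n+u<ᵇn
... | true  = ⊥-elim (ℕₚ.m+n≮m n (toℕ u) (ℕₚ.<ᵇ⇒< _ n (Equivalence.from T-≡ n+u<ᵇn)))
... | false = cong (λ t → suc (blockOf ns t)) (ℕₚ.m+n∸m≡n n (toℕ u))

tabulate-↑ : ∀ {A : Set} a b (g : Fin (a ℕ.+ b) → A) → tabulate g ≡ tabulate (g ∘ (_↑ˡ b)) ++ tabulate (g ∘ (a ↑ʳ_))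
tabulate-↑ zero    b g = refl
tabulate-↑ (suc a) b g = cong (g zero ∷_) (tabulate-↑ a b (g ∘ suc))

clusterAt : ℤ → ℕ → (ns : List ℕ) → Fin (sum ns) → Cluster
clusterAt y o ns u = cluster (o ℕ.+ blockOf ns (toℕ u)) (+ 1) (y - + blockSize ns (blockOf ns (toℕ u)))

clusters-tabulate : ∀ y o ns → clusters y o ns ≡ tabulate (clusterAt y o ns)
clusters-tabulate y o []       = refl
clusters-tabulate y o (n ∷ ns) = sym (begin
  tabulate (clusterAt y o (n ∷ ns))
    ≡⟨ tabulate-↑ n (sum ns) (clusterAt y o (n ∷ ns)) ⟩
  tabulate (clusterAt y o (n ∷ ns) ∘ (_↑ˡ sum ns)) ++ tabulate (clusterAt y o (n ∷ ns) ∘ (n ↑ʳ_))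
    ≡⟨ cong₂ _++_ (trans (Listₚ.tabulate-cong first-block) (tabulate-const n _))
                  (trans (Listₚ.tabulate-cong later-blocks) (sym (clusters-tabulate y (suc o) ns))) ⟩
  replicate n (cluster o (+ 1) (y - + n)) ++ clusters y (suc o) ns ∎)
  where
  open ≡-Reasoning
  tabulate-const : ∀ {A : Set} n (a : A) → tabulate {n = n} (λ _ → a) ≡ replicate n a
  tabulate-const zero    a = refl
  tabulate-const (suc n) a = cong (a ∷_) (tabulate-const n a)
  first-block : ∀ k → clusterAt y o (n ∷ ns) (k ↑ˡ sum ns) ≡ cluster o (+ 1) (y - + n)
  first-block k rewrite blockOf-↑ˡ n ns k | ℕₚ.+-identityʳ o = refl
  later-blocks : ∀ u → clusterAt y o (n ∷ ns) (n ↑ʳ u) ≡ clusterAt y (suc o) ns u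
  later-blocks u rewrite blockOf-↑ʳ n ns u | ℕₚ.+-suc o (blockOf ns (toℕ u)) = refl

-- Finite sums

module _ {c ℓ} (M : Monoid c ℓ) where
  open Monoid M using (Carrier; _≈_; _∙_; ∙-congˡ; identityˡ; assoc) renaming (sym to ≈-sym; trans to ≈-trans)
  open import Algebra.Properties.Monoid.Sum M using () renaming (sum to fold)

  sum-↑ : ∀ a b (f : Fin (a ℕ.+ b) → Carrier) → fold f ≈ fold (f ∘ (_↑ˡ b)) ∙ fold (f ∘ (a ↑ʳ_))
  sum-↑ zero    b f = ≈-sym (identityˡ _)
  sum-↑ (suc a) b f = ≈-trans (∙-congˡ (sum-↑ a b (f ∘ suc))) (≈-sym (assoc _ _ _))

∑-↑ : ∀ a b (f : Fin (a ℕ.+ b) → ℤ) → ∑ f ≡ ∑ (f ∘ (_↑ˡ b)) + ∑ (f ∘ (a ↑ʳ_))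
∑-↑ = sum-↑ ℤₚ.+-0-monoid

∏-↑ : ∀ a b (f : Fin (a ℕ.+ b) → ℤ) → ∏ f ≡ ∏ (f ∘ (_↑ˡ b)) * ∏ (f ∘ (a ↑ʳ_))
∏-↑ = sum-↑ ℤₚ.*-1-monoid

∑-zero : ∀ {n} {f : Fin n → ℤ} → (∀ k → f k ≡ + 0) → ∑ f ≡ + 0
∑-zero {n} f≗0 = trans (sum-cong-≗ f≗0) (sum-replicate-zero n)

∑-neg : ∀ {n} (f : Fin n → ℤ) → ∑ (λ k → - f k) ≡ - ∑ f
∑-neg f = trans (sum-cong-≗ (λ k → sym (ℤₚ.-1*i≡-i (f k)))) (trans (sym (*-distribˡ-sum -1ℤ f)) (ℤₚ.-1*i≡-i _))

∑-- : ∀ {n} (f g : Fin n → ℤ) → ∑ (λ k → f k - g k) ≡ ∑ f - ∑ g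
∑-- f g = trans (∑-distrib-+ f (λ k → - g k)) (cong (_+_ (∑ f)) (∑-neg g))

∑-const-1 : ∀ n → ∑ {n} (λ _ → + 1) ≡ + n
∑-const-1 zero    = refl
∑-const-1 (suc n) = trans (cong (_+_ (+ 1)) (∑-const-1 n)) (sym (ℤₚ.pos-+ 1 n))

∑-single : ∀ {n} (a : Fin n) (f : Fin n → ℤ) → (∀ k → k ≢ a → f k ≡ + 0) → ∑ f ≡ f a
∑-single zero f vanish = trans (cong (_+_ (f zero)) (∑-zero (λ k → vanish (suc k) (λ ())))) (ℤₚ.+-identityʳ (f zero))
∑-single (suc a) f vanish =
  trans (cong₂ _+_ (vanish zero (λ ())) (∑-single a (f ∘ suc) (λ k k≢a → vanish (suc k) (k≢a ∘ Finₚ.suc-injective))))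
    (ℤₚ.+-identityˡ (f (suc a)))

δ : ∀ {N} → Fin N → Fin N → ℤ
δ x y = if x ==F y then + 1 else + 0

δ-refl : ∀ {N} (x : Fin N) → δ x x ≡ + 1
δ-refl x with x Fin.≟ x
... | yes _   = refl
... | no x≢x = ⊥-elim (x≢x refl)

δ-≢ : ∀ {N} {x y : Fin N} → x ≢ y → δ x y ≡ + 0
δ-≢ {x = x} {y} x≢y with x Fin.≟ y
... | yes x≡y = ⊥-elim (x≢y x≡y)
... | no _    = refl

δ-sym : ∀ {N} (x y : Fin N) → δ x y ≡ δ y x
δ-sym x y with x Fin.≟ y | y Fin.≟ x
... | yes _   | yes _   = refl
... | no _    | no _    = refl
... | yes x≡y | no y≢x = ⊥-elim (y≢x (sym x≡y))
... | no x≢y  | yes y≡x = ⊥-elim (x≢y (sym y≡x))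

δ-guard : ∀ {N} (x y : Fin N) {s t : ℤ} → (x ≡ y → s ≡ t) → δ x y * s ≡ δ x y * t
δ-guard x y s≡t with x Fin.≟ y
... | yes x≡y = cong (+ 1 *_) (s≡t x≡y)
... | no _    = refl

∑-δˡ : ∀ {N} (a : Fin N) (g : Fin N → ℤ) → ∑ (λ v → δ v a * g v) ≡ g a
∑-δˡ a g = trans (∑-single a (λ v → δ v a * g v) (λ k k≢a → cong (_* g k) (δ-≢ k≢a)))
  (trans (cong (_* g a) (δ-refl a)) (ℤₚ.*-identityˡ (g a)))

∑-δʳ : ∀ {N} (a : Fin N) (g : Fin N → ℤ) → ∑ (λ v → δ a v * g v) ≡ g a
∑-δʳ a g = trans (sum-cong-≗ (λ v → cong (_* g v) (δ-sym a v))) (∑-δˡ a g)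

sumℤ-allFin : ∀ {n} (f : Fin n → ℤ) → sumℤ (map f (allFin n)) ≡ ∑ f
sumℤ-allFin f = trans (cong sumℤ (Listₚ.map-tabulate (λ x → x) f)) (go f)
  where
  go : ∀ {n} (f : Fin n → ℤ) → sumℤ (tabulate f) ≡ ∑ f
  go {zero}  f = refl
  go {suc n} f = cong (_+_ (f zero)) (go (f ∘ suc))

sumℤ-++ : ∀ xs ys → sumℤ (xs ++ ys) ≡ sumℤ xs + sumℤ ys
sumℤ-++ []       ys = sym (ℤₚ.+-identityˡ _)
sumℤ-++ (x ∷ xs) ys = trans (cong (_+_ x) (sumℤ-++ xs ys)) (sym (ℤₚ.+-assoc x (sumℤ xs) (sumℤ ys)))

sumℤ-concatMap : ∀ {A B : Set} (h : B → ℤ) (g : A → List B) (xs : List A) →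
  sumℤ (map h (concatMap g xs)) ≡ sumℤ (map (λ x → sumℤ (map h (g x))) xs)
sumℤ-concatMap h g []       = refl
sumℤ-concatMap h g (x ∷ xs) =
  trans (cong sumℤ (Listₚ.map-++ h (g x) (concatMap g xs)))
    (trans (sumℤ-++ (map h (g x)) (map h (concatMap g xs))) (cong (_+_ (sumℤ (map h (g x)))) (sumℤ-concatMap h g xs)))

ind : Bool → ℤ
ind true  = + 1
ind false = + 0

sumℤ-if : ∀ {B : Set} (h : B → ℤ) c (t : B) → sumℤ (map h (if c then t ∷ [] else [])) ≡ (if c then h t else + 0)
sumℤ-if h true  t = ℤₚ.+-identityʳ (h t)
sumℤ-if h false t = refl

∏-const : ∀ n (X : ℤ) → ∏ {n} (λ _ → X) ≡ X ^ n
∏-const zero    X = refl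
∏-const (suc n) X = cong (X *_) (∏-const n X)

∏-after : ∀ n (k : Fin n) X → ∏ {n} (λ j → if toℕ k ℕ.<ᵇ toℕ j then X else + 1) ≡ X ^ (n ∸ suc (toℕ k))
∏-after (suc n) zero    X = trans (ℤₚ.*-identityˡ _) (∏-const n X)
∏-after (suc n) (suc k) X = trans (ℤₚ.*-identityˡ _) (∏-after n k X)

-- Entries of the Helmholtzian of a graph

<⇒≢ : ∀ {N} {i j : Fin N} → toℕ i < toℕ j → i ≢ j
<⇒≢ i<j refl = ℕₚ.<-irrefl refl i<j

<ᵇ⇒< : ∀ {N} {i j : Fin N} → (i <F j) ≡ true → toℕ i < toℕ j
<ᵇ⇒< {i = i} {j} i<ᵇj = ℕₚ.<ᵇ⇒< (toℕ i) (toℕ j) (Equivalence.from T-≡ i<ᵇj)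

<⇒<ᵇ : ∀ {N} {i j : Fin N} → toℕ i < toℕ j → (i <F j) ≡ true
<⇒<ᵇ i<j = Equivalence.to T-≡ (ℕₚ.<⇒<ᵇ i<j)

≮⇒<F-false : ∀ {N} {i j : Fin N} → ¬ (toℕ i < toℕ j) → (i <F j) ≡ false
≮⇒<F-false {i = i} {j} i≮j with i <F j in i<ᵇj
... | true  = ⊥-elim (i≮j (<ᵇ⇒< i<ᵇj))
... | false = refl

<F-↑ˡ : ∀ {a} b (k j : Fin a) → ((k ↑ˡ b) <F (j ↑ˡ b)) ≡ (toℕ k ℕ.<ᵇ toℕ j)
<F-↑ˡ b k j = cong₂ ℕ._<ᵇ_ (Finₚ.toℕ-↑ˡ k b) (Finₚ.toℕ-↑ˡ j b)

<F-↑ʳ : ∀ a {b} (u w : Fin b) → ((a ↑ʳ u) <F (a ↑ʳ w)) ≡ (toℕ u ℕ.<ᵇ toℕ w)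
<F-↑ʳ a u w = trans (cong₂ ℕ._<ᵇ_ (Finₚ.toℕ-↑ʳ a u) (Finₚ.toℕ-↑ʳ a w)) (shift a)
  where
  shift : ∀ a → ((a ℕ.+ toℕ u) ℕ.<ᵇ (a ℕ.+ toℕ w)) ≡ (toℕ u ℕ.<ᵇ toℕ w)
  shift zero    = refl
  shift (suc a) = shift a

↑ˡ<↑ʳ : ∀ {a b} (k : Fin a) (w : Fin b) → toℕ (k ↑ˡ b) < toℕ (a ↑ʳ w)
↑ˡ<↑ʳ {a} {b} k w = subst₂ _<_ (sym (Finₚ.toℕ-↑ˡ k b)) (sym (Finₚ.toℕ-↑ʳ a w))
  (ℕₚ.<-≤-trans (Finₚ.toℕ<n k) (ℕₚ.m≤m+n a (toℕ w)))

isTriangle : ∀ {N} → Graph N → Fin N → Fin N → Fin N → Bool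
isTriangle G i j l = (i <F j) ∧ (j <F l) ∧ G i j ∧ G j l ∧ G i l

tri : ∀ {N} → Graph N → Fin N → Fin N → Fin N → ℤ
tri G i j l = ind (isTriangle G i j l)

bPart : ∀ {N} → Fin N × Fin N → Fin N × Fin N → ℤ
bPart {N} e f = sumℤ (map (λ v → bEntry e v * bEntry f v) (allFin N))

cPart : ∀ {N} → Graph N → Fin N × Fin N → Fin N × Fin N → ℤ
cPart G e f = sumℤ (map (λ t → cEntry t e * cEntry t f) (triangles G))

entry : ∀ {N} → Graph N → Fin N × Fin N → Fin N × Fin N → ℤ
entry G e f = bPart e f + cPart G e f

bEntry-≢ : ∀ {N} {t h : Fin N} (v : Fin N) → t ≢ h → bEntry (t , h) v ≡ δ v h - δ v t
bEntry-≢ {t = t} {h} v t≢h with v Fin.≟ h | v Fin.≟ t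
... | yes refl | yes refl = ⊥-elim (t≢h refl)
... | yes _    | no _     = refl
... | no _     | yes _    = refl
... | no _     | no _     = refl

bPart-≢ : ∀ {N} {a b c d : Fin N} → a ≢ b → c ≢ d → bPart (a , b) (c , d) ≡ δ b d - δ b c - (δ a d - δ a c)
bPart-≢ {a = a} {b} {c} {d} a≢b c≢d =
  trans (sumℤ-allFin (λ v → bEntry (a , b) v * bEntry (c , d) v))
    (trans (sum-cong-≗ (λ v → trans (cong₂ _*_ (bEntry-≢ v a≢b) (bEntry-≢ v c≢d)) (distrib (δ v b) (δ v a) (δ v d - δ v c))))
      (trans (∑-- (λ v → δ v b * (δ v d - δ v c)) (λ v → δ v a * (δ v d - δ v c)))
        (cong₂ _-_ (∑-δˡ b (λ v → δ v d - δ v c)) (∑-δˡ a (λ v → δ v d - δ v c)))))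
  where
  distrib : ∀ x y z → (x - y) * z ≡ x * z - y * z
  distrib = solve-∀

cEntry-ordered : ∀ {N} {i j l : Fin N} (a b : Fin N) → toℕ i < toℕ j → toℕ j < toℕ l →
  cEntry (i , j , l) (a , b) ≡ δ a i * δ b j + δ a j * δ b l - δ a i * δ b l
cEntry-ordered {i = i} {j} {l} a b i<j j<l with a Fin.≟ i | b Fin.≟ j | a Fin.≟ j | b Fin.≟ l
... | yes refl | _        | yes a≡j | _        = ⊥-elim (<⇒≢ i<j a≡j)
... | _        | yes refl | _        | yes b≡l = ⊥-elim (<⇒≢ j<l b≡l)
... | yes _ | yes _ | no _  | no _  = refl
... | yes _ | no _  | no _  | yes _ = refl
... | yes _ | no _  | no _  | no _  = refl
... | no _  | yes _ | yes _ | no _  = refl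
... | no _  | yes _ | no _  | no _  = refl
... | no _  | no _  | yes _ | yes _ = refl
... | no _  | no _  | yes _ | no _  = refl
... | no _  | no _  | no _  | yes _ = refl
... | no _  | no _  | no _  | no _  = refl

∑³ : ∀ {N} → (Fin N → Fin N → Fin N → ℤ) → ℤ
∑³ Y = ∑ λ i → ∑ λ j → ∑ λ l → Y i j l

∑³-cong : ∀ {N} {Y Z : Fin N → Fin N → Fin N → ℤ} → (∀ i j l → Y i j l ≡ Z i j l) → ∑³ Y ≡ ∑³ Z
∑³-cong Y≗Z = sum-cong-≗ (λ i → sum-cong-≗ (λ j → sum-cong-≗ (Y≗Z i j)))

∑³-+- : ∀ {N} (Y₁ Y₂ Y₃ : Fin N → Fin N → Fin N → ℤ) →
  ∑³ (λ i j l → Y₁ i j l + Y₂ i j l - Y₃ i j l) ≡ ∑³ Y₁ + ∑³ Y₂ - ∑³ Y₃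
∑³-+- Y₁ Y₂ Y₃ = trans (sum-cong-≗ (λ i → trans (sum-cong-≗ (λ j → inner (Y₁ i j) (Y₂ i j) (Y₃ i j)))
                                                  (inner (λ j → ∑ (Y₁ i j)) (λ j → ∑ (Y₂ i j)) (λ j → ∑ (Y₃ i j)))))
  (inner (λ i → ∑ λ j → ∑ (Y₁ i j)) (λ i → ∑ λ j → ∑ (Y₂ i j)) (λ i → ∑ λ j → ∑ (Y₃ i j)))
  where
  inner : ∀ {n} (f g h : Fin n → ℤ) → ∑ (λ k → f k + g k - h k) ≡ ∑ f + ∑ g - ∑ h
  inner f g h = trans (∑-- (λ k → f k + g k) h) (cong (_- ∑ h) (∑-distrib-+ f g))

∑-scale : ∀ {n} (c : ℤ) (f : Fin n → ℤ) → ∑ (λ k → c * f k) ≡ c * ∑ f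
∑-scale c f = sym (*-distribˡ-sum c f)

∑³-δ₁₂ : ∀ {N} (a b : Fin N) (Y : Fin N → Fin N → Fin N → ℤ) → ∑³ (λ i j l → δ a i * δ b j * Y i j l) ≡ ∑ (Y a b)
∑³-δ₁₂ a b Y =
  trans (sum-cong-≗ (λ i → trans (sum-cong-≗ (λ j → trans (sum-cong-≗ (λ l → ℤₚ.*-assoc (δ a i) (δ b j) (Y i j l)))
                     (trans (∑-scale (δ a i) (λ l → δ b j * Y i j l)) (cong (δ a i *_) (∑-scale (δ b j) (Y i j))))))
             (∑-scale (δ a i) (λ j → δ b j * ∑ (Y i j)))))
    (trans (∑-δʳ a (λ i → ∑ λ j → δ b j * ∑ (Y i j))) (∑-δʳ b (λ j → ∑ (Y a j))))

∑³-δ₂₃ : ∀ {N} (a b : Fin N) (Y : Fin N → Fin N → Fin N → ℤ) → ∑³ (λ i j l → δ a j * δ b l * Y i j l) ≡ ∑ (λ i → Y i a b)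
∑³-δ₂₃ a b Y =
  sum-cong-≗ (λ i → trans (sum-cong-≗ (λ j → trans (sum-cong-≗ (λ l → ℤₚ.*-assoc (δ a j) (δ b l) (Y i j l)))
                     (trans (∑-scale (δ a j) (λ l → δ b l * Y i j l)) (cong (δ a j *_) (∑-δʳ b (Y i j))))))
             (∑-δʳ a (λ j → Y i j b)))

∑³-δ₁₃ : ∀ {N} (a b : Fin N) (Y : Fin N → Fin N → Fin N → ℤ) → ∑³ (λ i j l → δ a i * δ b l * Y i j l) ≡ ∑ (λ j → Y a j b)
∑³-δ₁₃ a b Y =
  trans (sum-cong-≗ (λ i → trans (sum-cong-≗ (λ j → trans (sum-cong-≗ (λ l → ℤₚ.*-assoc (δ a i) (δ b l) (Y i j l)))
                     (trans (∑-scale (δ a i) (λ l → δ b l * Y i j l)) (cong (δ a i *_) (∑-δʳ b (Y i j))))))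
             (∑-scale (δ a i) (λ j → Y i j b))))
    (∑-δʳ a (λ i → ∑ λ j → Y i j b))

∑-δ-affine : ∀ {n} (k : ℤ) (d : Fin n) (g h : Fin n → ℤ) → ∑ (λ w → k * g w + δ d w * h w) ≡ k * ∑ g + h d
∑-δ-affine k d g h = trans (∑-distrib-+ (λ w → k * g w) (λ w → δ d w * h w)) (cong₂ _+_ (∑-scale k g) (∑-δʳ d h))

module _ {N} (G : Graph N) where

  isTriangle-ordered : ∀ i j l → isTriangle G i j l ≡ true → toℕ i < toℕ j × toℕ j < toℕ l
  isTriangle-ordered i j l t =
    let (i<j , rest) = Equivalence.to T-∧ (Equivalence.from T-≡ t)
        (j<l , _)    = Equivalence.to T-∧ rest
    in ℕₚ.<ᵇ⇒< (toℕ i) (toℕ j) i<j , ℕₚ.<ᵇ⇒< (toℕ j) (toℕ l) j<l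

  tri-unordered₁₂ : ∀ i j l → ¬ (toℕ i < toℕ j) → tri G i j l ≡ + 0
  tri-unordered₁₂ i j l i≮j with isTriangle G i j l in t
  ... | true  = ⊥-elim (i≮j (proj₁ (isTriangle-ordered i j l t)))
  ... | false = refl

  tri-unordered₂₃ : ∀ i j l → ¬ (toℕ j < toℕ l) → tri G i j l ≡ + 0
  tri-unordered₂₃ i j l j≮l with isTriangle G i j l in t
  ... | true  = ⊥-elim (j≮l (proj₂ (isTriangle-ordered i j l t)))
  ... | false = refl

  tri-ordered : ∀ i j l → toℕ i < toℕ j → toℕ j < toℕ l → tri G i j l ≡ ind (G i j ∧ G j l ∧ G i l)
  tri-ordered i j l i<j j<l rewrite <⇒<ᵇ i<j | <⇒<ᵇ j<l = refl

  cColumn : Fin N × Fin N → Fin N → Fin N → Fin N → ℤ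
  cColumn f i j l = if isTriangle G i j l then cEntry (i , j , l) f else + 0

  cColumn-formula : ∀ c d i j l → cColumn (c , d) i j l ≡ tri G i j l * (δ c i * δ d j + δ c j * δ d l - δ c i * δ d l)
  cColumn-formula c d i j l with isTriangle G i j l in t
  ... | true  = trans (cEntry-ordered c d (proj₁ (isTriangle-ordered i j l t)) (proj₂ (isTriangle-ordered i j l t))) (sym (ℤₚ.*-identityˡ _))
  ... | false = refl

  cPart-∑³ : ∀ e f → cPart G e f ≡ ∑³ (λ i j l → if isTriangle G i j l then cEntry (i , j , l) e * cEntry (i , j , l) f else + 0)
  cPart-∑³ e f =
    trans (sumℤ-concatMap h Ti (allFin N))
      (trans (sumℤ-allFin (λ i → sumℤ (map h (Ti i))))
        (sum-cong-≗ (λ i → trans (sumℤ-concatMap h (Tj i) (allFin N))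
          (trans (sumℤ-allFin (λ j → sumℤ (map h (Tj i j))))
            (sum-cong-≗ (λ j → trans (sumℤ-concatMap h (Tl i j) (allFin N))
              (trans (sumℤ-allFin (λ l → sumℤ (map h (Tl i j l))))
                (sum-cong-≗ (λ l → sumℤ-if h (isTriangle G i j l) (i , j , l))))))))))
    where
    h = λ t → cEntry t e * cEntry t f
    Tl : Fin N → Fin N → Fin N → List (Fin N × Fin N × Fin N)
    Tl i j l = if isTriangle G i j l then (i , j , l) ∷ [] else []
    Tj : Fin N → Fin N → List (Fin N × Fin N × Fin N)
    Tj i j = concatMap (Tl i j) (allFin N)
    Ti : Fin N → List (Fin N × Fin N × Fin N)
    Ti i = concatMap (Tj i) (allFin N)

  -- {a, b} can be the edge (i,j), (j,l) or (i,l) of a triangle i < j < l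
  cPart-by-position : ∀ a b f →
    cPart G (a , b) f ≡ ∑ (λ w → cColumn f a b w) + ∑ (λ w → cColumn f w a b) - ∑ (λ w → cColumn f a w b)
  cPart-by-position a b f =
    trans (cPart-∑³ (a , b) f)
      (trans (∑³-cong pointwise)
        (trans (∑³-+- (λ i j l → δ a i * δ b j * cColumn f i j l) (λ i j l → δ a j * δ b l * cColumn f i j l)
                      (λ i j l → δ a i * δ b l * cColumn f i j l))
          (cong₂ _-_ (cong₂ _+_ (∑³-δ₁₂ a b (cColumn f)) (∑³-δ₂₃ a b (cColumn f))) (∑³-δ₁₃ a b (cColumn f)))))
    where
    pointwise : ∀ i j l → (if isTriangle G i j l then cEntry (i , j , l) (a , b) * cEntry (i , j , l) f else + 0)
      ≡ δ a i * δ b j * cColumn f i j l + δ a j * δ b l * cColumn f i j l - δ a i * δ b l * cColumn f i j l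
    pointwise i j l with isTriangle G i j l in t
    ... | true  = trans (cong (_* cEntry (i , j , l) f) (cEntry-ordered a b (proj₁ (isTriangle-ordered i j l t)) (proj₂ (isTriangle-ordered i j l t))))
                    (distrib (δ a i) (δ b j) (δ a j) (δ b l) (cEntry (i , j , l) f))
      where
      distrib : ∀ ai bj aj bl x → (ai * bj + aj * bl - ai * bl) * x ≡ ai * bj * x + aj * bl * x - ai * bl * x
      distrib = solve-∀
    ... | false = sym (annihilate (δ a i) (δ b j) (δ a j) (δ b l))
      where
      annihilate : ∀ ai bj aj bl → ai * bj * + 0 + aj * bl * + 0 - ai * bl * + 0 ≡ + 0
      annihilate = solve-∀

  -- the number of triangles containing the edge {a, b}, once a < b
  triangleCount : Fin N → Fin N → ℤ
  triangleCount a b = ∑ (λ w → tri G a b w + tri G w a b + tri G a w b)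

  cPart-formula : ∀ a b c d → cPart G (a , b) (c , d) ≡
    δ c a * δ d b * triangleCount a b
      + ((δ c b - δ c a) * tri G a b d + (δ d a - δ d b) * tri G c a b - (δ c a * tri G a d b + δ d b * tri G a c b))
  cPart-formula a b c d = begin
    cPart G (a , b) (c , d)                                         ≡⟨ cPart-by-position a b (c , d) ⟩
    ∑ (cColumn (c , d) a b) + ∑ (λ w → cColumn (c , d) w a b) - ∑ (λ w → cColumn (c , d) a w b)
                                                                    ≡⟨ cong₂ _-_ (cong₂ _+_ first second) third ⟩
    (k * S₁ + (cb - ca) * tri G a b d) + (k * S₂ + (da - db) * tri G c a b)
      - (- k * S₃ + ca * tri G a d b + db * tri G a c b)            ≡⟨ regroup k S₁ S₂ S₃ (cb - ca) (da - db) ca db _ _ _ _ ⟩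
    k * (S₁ + S₂ + S₃)
      + ((cb - ca) * tri G a b d + (da - db) * tri G c a b - (ca * tri G a d b + db * tri G a c b))
                                                                    ≡⟨ cong (λ s → k * s + rest) (sym count) ⟩
    k * triangleCount a b
      + ((cb - ca) * tri G a b d + (da - db) * tri G c a b - (ca * tri G a d b + db * tri G a c b)) ∎
    where
    open ≡-Reasoning
    ca = δ c a
    cb = δ c b
    da = δ d a
    db = δ d b
    k = ca * db
    rest = (cb - ca) * tri G a b d + (da - db) * tri G c a b - (ca * tri G a d b + db * tri G a c b)
    S₁ = ∑ (tri G a b)
    S₂ = ∑ (λ w → tri G w a b)
    S₃ = ∑ (λ w → tri G a w b)
    count : triangleCount a b ≡ S₁ + S₂ + S₃
    count = trans (∑-distrib-+ (λ w → tri G a b w + tri G w a b) (λ w → tri G a w b))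
              (cong (_+ S₃) (∑-distrib-+ (tri G a b) (λ w → tri G w a b)))
    regroup : ∀ k S₁ S₂ S₃ x y ca db t₁ t₂ t₃ t₄ →
      (k * S₁ + x * t₁) + (k * S₂ + y * t₂) - (- k * S₃ + ca * t₃ + db * t₄)
        ≡ k * (S₁ + S₂ + S₃) + (x * t₁ + y * t₂ - (ca * t₃ + db * t₄))
    regroup = solve-∀
    first : ∑ (cColumn (c , d) a b) ≡ k * S₁ + (cb - ca) * tri G a b d
    first = trans (sum-cong-≗ (λ w → trans (cColumn-formula c d a b w) (split (tri G a b w) ca db cb (δ d w))))
              (∑-δ-affine k d (tri G a b) (λ w → (cb - ca) * tri G a b w))
      where
      split : ∀ t ca db cb dw → t * (ca * db + cb * dw - ca * dw) ≡ ca * db * t + dw * ((cb - ca) * t)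
      split = solve-∀
    second : ∑ (λ w → cColumn (c , d) w a b) ≡ k * S₂ + (da - db) * tri G c a b
    second = trans (sum-cong-≗ (λ w → trans (cColumn-formula c d w a b) (split (tri G w a b) ca db da (δ c w))))
               (∑-δ-affine k c (λ w → tri G w a b) (λ w → (da - db) * tri G w a b))
      where
      split : ∀ t ca db da cw → t * (cw * da + ca * db - cw * db) ≡ ca * db * t + cw * ((da - db) * t)
      split = solve-∀
    third : ∑ (λ w → cColumn (c , d) a w b) ≡ - k * S₃ + ca * tri G a d b + db * tri G a c b
    third = trans (sum-cong-≗ (λ w → trans (cColumn-formula c d a w b) (split (tri G a w b) ca db (δ d w) (δ c w))))
              (trans (∑-distrib-+ (λ w → - k * tri G a w b + δ d w * (ca * tri G a w b)) (λ w → δ c w * (db * tri G a w b)))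
                (cong₂ _+_ (∑-δ-affine (- k) d (λ w → tri G a w b) (λ w → ca * tri G a w b)) (∑-δʳ c (λ w → db * tri G a w b))))
      where
      split : ∀ t ca db dw cw → t * (ca * dw + cw * db - ca * db) ≡ - (ca * db) * t + dw * (ca * t) + cw * (db * t)
      split = solve-∀

module _ {N} (G : Graph N) where

  entry-formula : ∀ {a b c d} → a ≢ b → c ≢ d → entry G (a , b) (c , d) ≡
    (δ b d - δ b c - (δ a d - δ a c))
      + (δ c a * δ d b * triangleCount G a b
         + ((δ c b - δ c a) * tri G a b d + (δ d a - δ d b) * tri G c a b - (δ c a * tri G a d b + δ d b * tri G a c b)))
  entry-formula {a} {b} {c} {d} a≢b c≢d = cong₂ _+_ (bPart-≢ a≢b c≢d) (cPart-formula G a b c d)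

  entry-diagonal : ∀ {a b} → toℕ a < toℕ b → entry G (a , b) (a , b) ≡ + 2 + triangleCount G a b
  entry-diagonal {a} {b} a<b = trans (entry-formula (<⇒≢ a<b) (<⇒≢ a<b))
    (evaluate (δ-refl b) (δ-≢ (<⇒≢ a<b ∘ sym)) (δ-≢ (<⇒≢ a<b)) (δ-refl a)
      (tri-unordered₂₃ G a b b (ℕₚ.<-irrefl refl)) (tri-unordered₁₂ G a a b (ℕₚ.<-irrefl refl)))
    where
    S = triangleCount G a b
    value : ∀ S → (+ 1 - + 0 - (+ 0 - + 1)) + (+ 1 * + 1 * S + ((+ 0 - + 1) * + 0 + (+ 0 - + 1) * + 0 - (+ 1 * + 0 + + 1 * + 0)))
                  ≡ + 2 + S
    value = solve-∀
    evaluate : ∀ {bb ba ab aa t₁ t₂} → bb ≡ + 1 → ba ≡ + 0 → ab ≡ + 0 → aa ≡ + 1 → t₁ ≡ + 0 → t₂ ≡ + 0 →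
      (bb - ba - (ab - aa)) + (aa * bb * S + ((ab - aa) * t₁ + (ba - bb) * t₂ - (aa * t₁ + bb * t₂))) ≡ + 2 + S
    evaluate refl refl refl refl refl refl = value S

  entry-same-tail : ∀ {a b d} → toℕ a < toℕ b → toℕ a < toℕ d → b ≢ d →
    entry G (a , b) (a , d) ≡ + 1 - tri G a b d - tri G a d b
  entry-same-tail {a} {b} {d} a<b a<d b≢d = trans (entry-formula (<⇒≢ a<b) (<⇒≢ a<d))
    (evaluate (δ-≢ b≢d) (δ-≢ (<⇒≢ a<b ∘ sym)) (δ-≢ (<⇒≢ a<d)) (δ-refl a) (δ-≢ (b≢d ∘ sym)) (δ-≢ (<⇒≢ a<b))
      (δ-≢ (<⇒≢ a<d ∘ sym)) (tri-unordered₁₂ G a a b (ℕₚ.<-irrefl refl)))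
    where
    S = triangleCount G a b
    value : ∀ S t₁ t₃ → (+ 0 - + 0 - (+ 0 - + 1)) + (+ 1 * + 0 * S + ((+ 0 - + 1) * t₁ + (+ 0 - + 0) * + 0 - (+ 1 * t₃ + + 0 * + 0)))
                        ≡ + 1 - t₁ - t₃
    value = solve-∀
    evaluate : ∀ {bd ba ad aa db ab da t₂} →
      bd ≡ + 0 → ba ≡ + 0 → ad ≡ + 0 → aa ≡ + 1 → db ≡ + 0 → ab ≡ + 0 → da ≡ + 0 → t₂ ≡ + 0 →
      (bd - ba - (ad - aa)) + (aa * db * S + ((ab - aa) * tri G a b d + (da - db) * t₂ - (aa * tri G a d b + db * t₂)))
        ≡ + 1 - tri G a b d - tri G a d b
    evaluate refl refl refl refl refl refl refl refl = value S (tri G a b d) (tri G a d b)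

  -- edges with different tails meet in at most one vertex, and their interaction there
  -- is cancelled exactly when the triangle on the two edges is present
  entry-different-tails : ∀ {a b c d} → toℕ a < toℕ b → toℕ c < toℕ d → toℕ a < toℕ c → G a b ≡ true → G c d ≡ true →
    entry G (a , b) (c , d) ≡ δ b d * (+ 1 - ind (G a c)) - δ b c * (+ 1 - ind (G a d))
  entry-different-tails {a} {b} {c} {d} a<b c<d a<c ab cd = begin
    entry G (a , b) (c , d)
      ≡⟨ entry-formula (<⇒≢ a<b) (<⇒≢ c<d) ⟩
    (δ b d - δ b c - (δ a d - δ a c))
      + (δ c a * δ d b * S + ((δ c b - δ c a) * tri G a b d + (δ d a - δ d b) * tri G c a b - (δ c a * tri G a d b + δ d b * tri G a c b)))
      ≡⟨ evaluate (δ-≢ (<⇒≢ a<d)) (δ-≢ (<⇒≢ a<c)) (δ-≢ (<⇒≢ a<c ∘ sym)) (δ-≢ (<⇒≢ a<d ∘ sym))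
                  (tri-unordered₁₂ G c a b (ℕₚ.<-asym a<c)) ⟩
    δ b d - δ b c + δ c b * tri G a b d - δ d b * tri G a c b
      ≡⟨ cong₂ (λ s t → δ b d - δ b c + s - t) closes-at-b closes-at-d ⟩
    δ b d - δ b c + δ b c * ind (G a d) - δ b d * ind (G a c)
      ≡⟨ regroup (δ b d) (δ b c) (ind (G a d)) (ind (G a c)) ⟩
    δ b d * (+ 1 - ind (G a c)) - δ b c * (+ 1 - ind (G a d)) ∎
    where
    open ≡-Reasoning
    a<d = ℕₚ.<-trans a<c c<d
    S = triangleCount G a b
    value : ∀ bd bc db S cb t₁ t₃ t₄ → (bd - bc - (+ 0 - + 0)) + (+ 0 * db * S + ((cb - + 0) * t₁ + (+ 0 - db) * + 0 - (+ 0 * t₃ + db * t₄)))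
                                       ≡ bd - bc + cb * t₁ - db * t₄
    value = solve-∀
    evaluate : ∀ {ad ac ca da t₂} → ad ≡ + 0 → ac ≡ + 0 → ca ≡ + 0 → da ≡ + 0 → t₂ ≡ + 0 →
      (δ b d - δ b c - (ad - ac)) + (ca * δ d b * S + ((δ c b - ca) * tri G a b d + (da - δ d b) * t₂ - (ca * tri G a d b + δ d b * tri G a c b)))
        ≡ δ b d - δ b c + δ c b * tri G a b d - δ d b * tri G a c b
    evaluate refl refl refl refl refl = value (δ b d) (δ b c) (δ d b) S (δ c b) (tri G a b d) (tri G a d b) (tri G a c b)
    regroup : ∀ bd bc X Y → bd - bc + bc * X - bd * Y ≡ bd * (+ 1 - Y) - bc * (+ 1 - X)
    regroup = solve-∀
    closes-at-b : δ c b * tri G a b d ≡ δ b c * ind (G a d)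
    closes-at-b = trans (δ-guard c b (λ { refl → trans (tri-ordered G a c d a<b c<d) (cong₂ (λ s t → ind (s ∧ t ∧ G a d)) ab cd) }))
                    (cong (_* ind (G a d)) (δ-sym c b))
    closes-at-d : δ d b * tri G a c b ≡ δ b d * ind (G a c)
    closes-at-d = trans (δ-guard d b (λ { refl → trans (tri-ordered G a c d a<c c<d)
                                       (trans (cong₂ (λ s t → ind (G a c ∧ s ∧ t)) cd ab) (cong ind (∧-identityʳ (G a c)))) }))
                    (cong (_* ind (G a c)) (δ-sym d b))

module _ {N} (G : Graph N) (G-sym : ∀ u v → G u v ≡ G v u) (G-irrefl : ∀ v → G v v ≡ false) where

  triangles-through-edge : ∀ {a b} w → toℕ a < toℕ b → G a b ≡ true →
    tri G a b w + tri G w a b + tri G a w b ≡ ind (G a w ∧ G b w)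
  triangles-through-edge {a} {b} w a<b ab with ℕₚ.<-cmp (toℕ w) (toℕ a)
  ... | tri< w<a _ _ = begin
    tri G a b w + tri G w a b + tri G a w b
      ≡⟨ cong₂ (λ s t → s + tri G w a b + t) (tri-unordered₂₃ G a b w (ℕₚ.<-asym (ℕₚ.<-trans w<a a<b)))
                                             (tri-unordered₁₂ G a w b (ℕₚ.<-asym w<a)) ⟩
    + 0 + tri G w a b + + 0                 ≡⟨ trans (ℤₚ.+-identityʳ _) (ℤₚ.+-identityˡ _) ⟩
    tri G w a b                             ≡⟨ tri-ordered G w a b w<a a<b ⟩
    ind (G w a ∧ G a b ∧ G w b)             ≡⟨ cong₂ (λ s t → ind (s ∧ G a b ∧ t)) (G-sym w a) (G-sym w b) ⟩
    ind (G a w ∧ G a b ∧ G b w)             ≡⟨ cong (λ s → ind (G a w ∧ s ∧ G b w)) ab ⟩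
    ind (G a w ∧ G b w)                     ∎
    where open ≡-Reasoning
  ... | tri≈ _ w≡a _ rewrite Finₚ.toℕ-injective w≡a =
    trans (cong₂ (λ s t → s + t + t) (tri-unordered₂₃ G a b a (ℕₚ.<-asym a<b)) (tri-unordered₁₂ G a a b (ℕₚ.<-irrefl refl)))
      (cong (λ s → ind (s ∧ G b a)) (sym (G-irrefl a)))
  ... | tri> _ _ a<w with ℕₚ.<-cmp (toℕ w) (toℕ b)
  ... | tri< w<b _ _ = begin
    tri G a b w + tri G w a b + tri G a w b
      ≡⟨ cong₂ (λ s t → s + t + tri G a w b) (tri-unordered₂₃ G a b w (ℕₚ.<-asym w<b)) (tri-unordered₁₂ G w a b (ℕₚ.<-asym a<w)) ⟩
    + 0 + + 0 + tri G a w b                 ≡⟨ ℤₚ.+-identityˡ _ ⟩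
    tri G a w b                             ≡⟨ tri-ordered G a w b a<w w<b ⟩
    ind (G a w ∧ G w b ∧ G a b)             ≡⟨ cong₂ (λ s t → ind (G a w ∧ s ∧ t)) (G-sym w b) ab ⟩
    ind (G a w ∧ G b w ∧ true)              ≡⟨ cong (λ s → ind (G a w ∧ s)) (∧-identityʳ (G b w)) ⟩
    ind (G a w ∧ G b w)                     ∎
    where open ≡-Reasoning
  ... | tri≈ _ w≡b _ rewrite Finₚ.toℕ-injective w≡b =
    trans (cong₂ (λ s t → s + t + s) (tri-unordered₂₃ G a b b (ℕₚ.<-irrefl refl)) (tri-unordered₁₂ G b a b (ℕₚ.<-asym a<b)))
      (sym (trans (cong (λ s → ind (G a b ∧ s)) (G-irrefl b)) (cong ind (∧-zeroʳ (G a b)))))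
  ... | tri> _ _ b<w = begin
    tri G a b w + tri G w a b + tri G a w b
      ≡⟨ cong₂ (λ s t → tri G a b w + s + t) (tri-unordered₁₂ G w a b (ℕₚ.<-asym (ℕₚ.<-trans a<b b<w)))
                                             (tri-unordered₂₃ G a w b (ℕₚ.<-asym b<w)) ⟩
    tri G a b w + + 0 + + 0                 ≡⟨ trans (ℤₚ.+-identityʳ _) (ℤₚ.+-identityʳ _) ⟩
    tri G a b w                             ≡⟨ tri-ordered G a b w a<b b<w ⟩
    ind (G a b ∧ G b w ∧ G a w)             ≡⟨ cong (λ s → ind (s ∧ G b w ∧ G a w)) ab ⟩
    ind (G b w ∧ G a w)                     ≡⟨ cong ind (∧-comm (G b w) (G a w)) ⟩
    ind (G a w ∧ G b w)                     ∎
    where open ≡-Reasoning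

  entry-diagonal-common-neighbours : ∀ {a b} → toℕ a < toℕ b → G a b ≡ true →
    entry G (a , b) (a , b) ≡ + 2 + ∑ (λ w → ind (G a w ∧ G b w))
  entry-diagonal-common-neighbours a<b ab =
    trans (entry-diagonal G a<b) (cong (_+_ (+ 2)) (sum-cong-≗ (λ w → triangles-through-edge w a<b ab)))

  entry-same-tail-symmetric : ∀ {a b d} → toℕ a < toℕ b → toℕ a < toℕ d → b ≢ d → G a b ≡ true → G a d ≡ true →
    entry G (a , b) (a , d) ≡ + 1 - ind (G b d)
  entry-same-tail-symmetric {a} {b} {d} a<b a<d b≢d ab ad with ℕₚ.<-cmp (toℕ b) (toℕ d)
  ... | tri< b<d _ _ = begin
    entry G (a , b) (a , d)               ≡⟨ entry-same-tail G a<b a<d b≢d ⟩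
    + 1 - tri G a b d - tri G a d b       ≡⟨ cong₂ (λ s t → + 1 - s - t) closes (tri-unordered₂₃ G a d b (ℕₚ.<-asym b<d)) ⟩
    + 1 - ind (G b d) - + 0               ≡⟨ ℤₚ.+-identityʳ _ ⟩
    + 1 - ind (G b d)                     ∎
    where
    open ≡-Reasoning
    closes : tri G a b d ≡ ind (G b d)
    closes = trans (tri-ordered G a b d a<b b<d)
               (trans (cong₂ (λ s t → ind (s ∧ G b d ∧ t)) ab ad) (cong ind (∧-identityʳ (G b d))))
  ... | tri≈ _ b≡d _ = ⊥-elim (b≢d (Finₚ.toℕ-injective b≡d))
  ... | tri> _ _ d<b = begin
    entry G (a , b) (a , d)               ≡⟨ entry-same-tail G a<b a<d b≢d ⟩
    + 1 - tri G a b d - tri G a d b       ≡⟨ cong₂ (λ s t → + 1 - s - t) (tri-unordered₂₃ G a b d (ℕₚ.<-asym d<b)) closes ⟩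
    + 1 - ind (G b d)                     ∎
    where
    open ≡-Reasoning
    closes : tri G a d b ≡ ind (G b d)
    closes = trans (tri-ordered G a d b a<d d<b)
               (trans (cong₂ (λ s t → ind (s ∧ G d b ∧ t)) ad ab) (cong ind (trans (∧-identityʳ (G d b)) (G-sym d b))))

module EdgeMatrix {N} (G : Graph N) (x : ℤ) = LabelledMatrix (λ e → x - entry G e e) (λ e f → + 0 - entry G e f)

charPolyAt-helmholtzian : ∀ {N} (G : Graph N) x → charPolyAt (helmholtzian G) x ≡ EdgeMatrix.detL G x (edges G)
charPolyAt-helmholtzian G x = det-cong entrywise
  where
  entrywise : ∀ i j → (if ⌊ i Fin.≟ j ⌋ then x else + 0) - helmholtzian G i j ≡ EdgeMatrix.mat G x (lookup (edges G)) i j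
  entrywise i j with i Fin.≟ j
  ... | yes refl = refl
  ... | no _     = refl

module _ {N} (G : Graph N) where

  edgeAt : Fin N → Fin N → List (Fin N × Fin N)
  edgeAt i j = if (i <F j) ∧ G i j then (i , j) ∷ [] else []

  edgesFrom : Fin N → List (Fin N × Fin N)
  edgesFrom i = concat (tabulate (edgeAt i))

  edges-by-tail : edges G ≡ concat (tabulate edgesFrom)
  edges-by-tail = trans (cong concat (Listₚ.map-tabulate (λ i → i) (λ i → concatMap (edgeAt i) (allFin N))))
    (cong concat (Listₚ.tabulate-cong (λ i → cong concat (Listₚ.map-tabulate (λ j → j) (edgeAt i)))))

  IsEdge : Fin N → Fin N → Fin N × Fin N → Set
  IsEdge i j e = e ≡ (i , j) × toℕ i < toℕ j × G i j ≡ true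

  edgeAt-edge : ∀ i j → All (IsEdge i j) (edgeAt i j)
  edgeAt-edge i j with (i <F j) ∧ G i j in i→j
  ... | true  = let (i<j , ij) = Equivalence.to T-∧ (Equivalence.from T-≡ i→j)
                in (refl , ℕₚ.<ᵇ⇒< (toℕ i) (toℕ j) i<j , Equivalence.to T-≡ ij) ∷ []
  ... | false = []

  edgesFrom-edge : ∀ i → All (λ e → Σ (Fin N) λ j → IsEdge i j e) (edgesFrom i)
  edgesFrom-edge i = concat⁺ (tabulate⁺ (λ j → All.map (j ,_) (edgeAt-edge i j)))

  edgeAt-present : ∀ {i j} → toℕ i < toℕ j → G i j ≡ true → edgeAt i j ≡ (i , j) ∷ []
  edgeAt-present i<j ij rewrite <⇒<ᵇ i<j | ij = refl

  module _ (x : ℤ) where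
    private
      module E = EdgeMatrix G x

    headFactor : Fin N → Fin N → ℤ
    headFactor i j = if (i <F j) ∧ G i j then x - entry G (i , j) (i , j) else + 1

    detL-edgeAt : ∀ i j → E.detL (edgeAt i j) ≡ headFactor i j
    detL-edgeAt i j with (i <F j) ∧ G i j
    ... | true  = E.detL-[ i , j ]
    ... | false = refl

    detL-heads : ∀ {n} i (h : Fin n → Fin N) →
      (∀ k k′ → k Fin.< k′ → toℕ i < toℕ (h k) → toℕ i < toℕ (h k′) → G i (h k) ≡ true → G i (h k′) ≡ true →
         entry G (i , h k) (i , h k′) ≡ + 0) →
      E.detL (concat (tabulate (edgeAt i ∘ h))) ≡ ∏ (headFactor i ∘ h)
    detL-heads i h heads-decoupled = trans (E.detL-concat (edgeAt i ∘ h) decoupled) (∏-cong (detL-edgeAt i ∘ h))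
      where
      decoupled : ∀ k k′ → k Fin.< k′ → E.Decoupled (edgeAt i (h k)) (edgeAt i (h k′))
      decoupled k k′ k<k′ = All.map (λ { (refl , i<k , ik) → All.map (λ { (refl , i<k′ , ik′) →
        cong (_-_ (+ 0)) (heads-decoupled k k′ k<k′ i<k i<k′ ik ik′) }) (edgeAt-edge i (h k′)) }) (edgeAt-edge i (h k))

-- The join graph

compatible : ℕ → ℕ → Bool
compatible x y = (x ℕ.≡ᵇ 0) ∨ (y ℕ.≡ᵇ 0) ∨ (x ℕ.≡ᵇ y)

Compatible : ℕ → ℕ → Set
Compatible x y = x ≡ 0 ⊎ y ≡ 0 ⊎ x ≡ y

compatible⇒ : ∀ {x y} → compatible x y ≡ true → Compatible x y
compatible⇒ {x} {y} c with Equivalence.to T-∨ (Equivalence.from T-≡ c)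
... | inj₁ x≡0 = inj₁ (ℕₚ.≡ᵇ⇒≡ x 0 x≡0)
... | inj₂ rest with Equivalence.to T-∨ rest
... | inj₁ y≡0 = inj₂ (inj₁ (ℕₚ.≡ᵇ⇒≡ y 0 y≡0))
... | inj₂ x≡y = inj₂ (inj₂ (ℕₚ.≡ᵇ⇒≡ x y x≡y))

⇒compatible : ∀ {x y} → Compatible x y → compatible x y ≡ true
⇒compatible {x} {y} c = Equivalence.to T-≡ (Equivalence.from T-∨ (case c))
  where
  case : Compatible x y → T (x ℕ.≡ᵇ 0) ⊎ T ((y ℕ.≡ᵇ 0) ∨ (x ℕ.≡ᵇ y))
  case (inj₁ x≡0)        = inj₁ (ℕₚ.≡⇒≡ᵇ x 0 x≡0)
  case (inj₂ (inj₁ y≡0)) = inj₂ (Equivalence.from T-∨ (inj₁ (ℕₚ.≡⇒≡ᵇ y 0 y≡0)))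
  case (inj₂ (inj₂ x≡y)) = inj₂ (Equivalence.from T-∨ (inj₂ (ℕₚ.≡⇒≡ᵇ x y x≡y)))

Compatible-sym : ∀ {x y} → Compatible x y → Compatible y x
Compatible-sym (inj₁ x≡0)        = inj₂ (inj₁ x≡0)
Compatible-sym (inj₂ (inj₁ y≡0)) = inj₁ y≡0
Compatible-sym (inj₂ (inj₂ x≡y)) = inj₂ (inj₂ (sym x≡y))

∑-block-indicator : ∀ ns β → ∑ {sum ns} (λ u → ind (blockOf ns (toℕ u) ℕ.≡ᵇ β)) ≡ + blockSize ns β
∑-block-indicator []       β = refl
∑-block-indicator (n ∷ ns) β = begin
  ∑ {n ℕ.+ sum ns} (λ u → ind (blockOf (n ∷ ns) (toℕ u) ℕ.≡ᵇ β))
    ≡⟨ ∑-↑ n (sum ns) (λ u → ind (blockOf (n ∷ ns) (toℕ u) ℕ.≡ᵇ β)) ⟩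
  ∑ {n} (λ k → ind (blockOf (n ∷ ns) (toℕ (k ↑ˡ sum ns)) ℕ.≡ᵇ β))
    + ∑ {sum ns} (λ u → ind (blockOf (n ∷ ns) (toℕ (n ↑ʳ u)) ℕ.≡ᵇ β))
    ≡⟨ cong₂ _+_ (sum-cong-≗ (λ k → cong (λ b → ind (b ℕ.≡ᵇ β)) (blockOf-↑ˡ n ns k)))
                 (sum-cong-≗ (λ u → cong (λ b → ind (b ℕ.≡ᵇ β)) (blockOf-↑ʳ n ns u))) ⟩
  ∑ {n} (λ _ → ind (0 ℕ.≡ᵇ β)) + ∑ {sum ns} (λ u → ind (suc (blockOf ns (toℕ u)) ℕ.≡ᵇ β))
    ≡⟨ by-block β ⟩
  + blockSize (n ∷ ns) β ∎
  where
  open ≡-Reasoning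
  by-block : ∀ β → ∑ {n} (λ _ → ind (0 ℕ.≡ᵇ β)) + ∑ {sum ns} (λ u → ind (suc (blockOf ns (toℕ u)) ℕ.≡ᵇ β))
                   ≡ + blockSize (n ∷ ns) β
  by-block zero    = trans (cong₂ _+_ (∑-const-1 n) (∑-zero {sum ns} (λ _ → refl))) (ℤₚ.+-identityʳ _)
  by-block (suc β) = trans (cong₂ _+_ (∑-zero {n} (λ _ → refl)) (∑-block-indicator ns β)) (ℤₚ.+-identityˡ _)

module JoinGraph (n0 : ℕ) (ns : List ℕ) where

  m : ℕ
  m = sum ns

  N : ℕ
  N = n0 ℕ.+ m

  G : Graph N
  G = joinGraph n0 ns

  partOf : Fin N → ℕ
  partOf v = part n0 ns (toℕ v)

  blk : Fin m → ℕ
  blk u = blockOf ns (toℕ u)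

  partOf-inner : ∀ v → toℕ v < n0 → partOf v ≡ 0
  partOf-inner v v<n0 rewrite Equivalence.to T-≡ (ℕₚ.<⇒<ᵇ v<n0) = refl

  partOf-outer : ∀ v → n0 ≤ toℕ v → partOf v ≡ suc (blockOf ns (toℕ v ∸ n0))
  partOf-outer v n0≤v with toℕ v ℕ.<ᵇ n0 in v<ᵇn0
  ... | true  = ⊥-elim (ℕₚ.<⇒≱ (ℕₚ.<ᵇ⇒< (toℕ v) n0 (Equivalence.from T-≡ v<ᵇn0)) n0≤v)
  ... | false = refl

  partOf≡0⇒inner : ∀ v → partOf v ≡ 0 → toℕ v < n0
  partOf≡0⇒inner v v≡0 with toℕ v ℕ.<? n0
  ... | yes v<n0 = v<n0
  ... | no v≮n0 with trans (sym (partOf-outer v (ℕₚ.≮⇒≥ v≮n0))) v≡0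
  ... | ()

  partOf-↑ˡ : ∀ k → partOf (k ↑ˡ m) ≡ 0
  partOf-↑ˡ k = partOf-inner (k ↑ˡ m) (subst (_< n0) (sym (Finₚ.toℕ-↑ˡ k m)) (Finₚ.toℕ<n k))

  partOf-↑ʳ : ∀ u → partOf (n0 ↑ʳ u) ≡ suc (blk u)
  partOf-↑ʳ u = trans (partOf-outer (n0 ↑ʳ u) (subst (n0 ≤_) (sym (Finₚ.toℕ-↑ʳ n0 u)) (ℕₚ.m≤m+n n0 (toℕ u))))
    (cong (λ t → suc (blockOf ns t)) (trans (cong (_∸ n0) (Finₚ.toℕ-↑ʳ n0 u)) (ℕₚ.m+n∸m≡n n0 (toℕ u))))

  G-irrefl : ∀ v → G v v ≡ false
  G-irrefl v with v Fin.≟ v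
  ... | yes _   = refl
  ... | no v≢v = ⊥-elim (v≢v refl)

  G-≢ : ∀ {u v} → u ≢ v → G u v ≡ compatible (partOf u) (partOf v)
  G-≢ {u} {v} u≢v with u Fin.≟ v
  ... | yes u≡v = ⊥-elim (u≢v u≡v)
  ... | no _    = refl

  adjacent⇒ : ∀ {u v} → G u v ≡ true → u ≢ v × Compatible (partOf u) (partOf v)
  adjacent⇒ {u} {v} uv with u Fin.≟ v
  adjacent⇒ () | yes refl
  ... | no u≢v = u≢v , compatible⇒ uv

  ⇒adjacent : ∀ {u v} → u ≢ v → Compatible (partOf u) (partOf v) → G u v ≡ true
  ⇒adjacent u≢v c = trans (G-≢ u≢v) (⇒compatible c)

  G-sym : ∀ u v → G u v ≡ G v u
  G-sym u v with G u v in uv | G v u in vu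
  ... | true  | true  = refl
  ... | false | false = refl
  ... | true  | false = let (u≢v , c) = adjacent⇒ uv in sym (trans (sym vu) (⇒adjacent (u≢v ∘ sym) (Compatible-sym c)))
  ... | false | true  = let (v≢u , c) = adjacent⇒ vu in trans (sym uv) (⇒adjacent (v≢u ∘ sym) (Compatible-sym c))

  -- the inner vertices K_{n0} come first, so a neighbour of b is a neighbour of every earlier neighbour of b
  earlier-neighbour : ∀ {a b w} → toℕ a < toℕ b → G a b ≡ true → G w b ≡ true → w ≢ a → G a w ≡ true
  earlier-neighbour {a} {b} {w} a<b ab wb w≢a = ⇒adjacent (w≢a ∘ sym) (compatible-aw (proj₂ (adjacent⇒ ab)) (proj₂ (adjacent⇒ wb)))
    where
    compatible-aw : Compatible (partOf a) (partOf b) → Compatible (partOf w) (partOf b) → Compatible (partOf a) (partOf w)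
    compatible-aw _                 (inj₁ w≡0)        = inj₂ (inj₁ w≡0)
    compatible-aw _                 (inj₂ (inj₁ b≡0)) = inj₁ (partOf-inner a (ℕₚ.<-trans a<b (partOf≡0⇒inner b b≡0)))
    compatible-aw (inj₁ a≡0)        (inj₂ (inj₂ _))   = inj₁ a≡0
    compatible-aw (inj₂ (inj₁ b≡0)) (inj₂ (inj₂ w≡b)) = inj₂ (inj₁ (trans w≡b b≡0))
    compatible-aw (inj₂ (inj₂ a≡b)) (inj₂ (inj₂ w≡b)) = inj₂ (inj₂ (trans a≡b (sym w≡b)))

  entry-join-different-tails : ∀ {a b c d} → toℕ a < toℕ b → toℕ c < toℕ d → toℕ a < toℕ c →
    G a b ≡ true → G c d ≡ true → entry G (a , b) (c , d) ≡ + 0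
  entry-join-different-tails {a} {b} {c} {d} a<b c<d a<c ab cd =
    trans (entry-different-tails G a<b c<d a<c ab cd) (cong₂ _-_ (vanish b d closes-at-d) (vanish b c closes-at-c))
    where
    vanish : ∀ x y {z} → (x ≡ y → G a z ≡ true) → δ x y * (+ 1 - ind (G a z)) ≡ + 0
    vanish x y closes = trans (δ-guard x y (λ x≡y → cong (λ t → + 1 - ind t) (closes x≡y))) (ℤₚ.*-zeroʳ (δ x y))
    closes-at-d : b ≡ d → G a c ≡ true
    closes-at-d refl = earlier-neighbour a<b ab cd (<⇒≢ a<c ∘ sym)
    closes-at-c : b ≡ c → G a d ≡ true
    closes-at-c refl = earlier-neighbour a<b ab (trans (G-sym d b) cd) (<⇒≢ (ℕₚ.<-trans a<c c<d) ∘ sym)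

  closedNeighbour : Fin N → Fin N → ℤ
  closedNeighbour w b = ind (compatible (partOf w) (partOf b))

  common-neighbour : ∀ {a b} w → toℕ a < toℕ b → G a b ≡ true →
    ind (G a w ∧ G b w) ≡ closedNeighbour w b - δ w a - δ w b
  common-neighbour {a} {b} w a<b ab with w Fin.≟ a | w Fin.≟ b
  ... | yes refl | yes w≡b = ⊥-elim (<⇒≢ a<b w≡b)
  ... | yes refl | no _ rewrite G-irrefl w | ⇒compatible (proj₂ (adjacent⇒ ab)) = refl
  ... | no _ | yes refl rewrite G-irrefl w | ⇒compatible {partOf w} (inj₂ (inj₂ refl)) = cong ind (∧-zeroʳ (G a w))
  ... | no w≢a | no w≢b = trans (cong ind both) (sym (trans (ℤₚ.+-identityʳ _) (ℤₚ.+-identityʳ _)))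
    where
    both : (G a w ∧ G b w) ≡ compatible (partOf w) (partOf b)
    both with compatible (partOf w) (partOf b) in wb
    ... | true  = cong₂ _∧_ (earlier-neighbour a<b ab (⇒adjacent w≢b (compatible⇒ wb)) w≢a)
                    (⇒adjacent (w≢b ∘ sym) (Compatible-sym (compatible⇒ wb)))
    ... | false = trans (cong (G a w ∧_) bw) (∧-zeroʳ (G a w))
      where
      bw : G b w ≡ false
      bw with G b w in bw′
      ... | false = refl
      ... | true  = trans (sym (⇒compatible (Compatible-sym (proj₂ (adjacent⇒ bw′))))) wb

  entry-join-diagonal : ∀ {a b} → toℕ a < toℕ b → G a b ≡ true → entry G (a , b) (a , b) ≡ ∑ (λ w → closedNeighbour w b)
  entry-join-diagonal {a} {b} a<b ab = begin
    entry G (a , b) (a , b)                                       ≡⟨ entry-diagonal-common-neighbours G G-sym G-irrefl a<b ab ⟩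
    + 2 + ∑ (λ w → ind (G a w ∧ G b w))                           ≡⟨ cong (_+_ (+ 2)) (sum-cong-≗ (λ w → common-neighbour w a<b ab)) ⟩
    + 2 + ∑ (λ w → closedNeighbour w b - δ w a - δ w b)
      ≡⟨ cong (_+_ (+ 2)) (trans (∑-- (λ w → closedNeighbour w b - δ w a) (δ-column b)) (cong (_- ∑ (δ-column b)) (∑-- _ (δ-column a)))) ⟩
    + 2 + (C - ∑ (δ-column a) - ∑ (δ-column b))                   ≡⟨ cong₂ (λ s t → + 2 + (C - s - t)) (∑-δ-column a) (∑-δ-column b) ⟩
    + 2 + (C - + 1 - + 1)                                         ≡⟨ cancel C ⟩
    C                                                             ∎
    where
    open ≡-Reasoning
    C = ∑ (λ w → closedNeighbour w b)
    δ-column : Fin N → Fin N → ℤ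
    δ-column x w = δ w x
    ∑-δ-column : ∀ x → ∑ (δ-column x) ≡ + 1
    ∑-δ-column x = trans (sum-cong-≗ (λ w → sym (ℤₚ.*-identityʳ (δ w x)))) (∑-δˡ x (λ _ → + 1))
    cancel : ∀ C → + 2 + (C - + 1 - + 1) ≡ C
    cancel = solve-∀

  closedNeighbourhood-inner : ∀ {b} → partOf b ≡ 0 → ∑ (λ w → closedNeighbour w b) ≡ + N
  closedNeighbourhood-inner {b} b≡0 = trans (sum-cong-≗ (λ w → cong ind (⇒compatible {partOf w} (inj₂ (inj₁ b≡0))))) (∑-const-1 N)

  closedNeighbourhood-outer : ∀ {b} β → partOf b ≡ suc β → ∑ (λ w → closedNeighbour w b) ≡ + (n0 ℕ.+ blockSize ns β)
  closedNeighbourhood-outer {b} β b≡β = begin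
    ∑ (λ w → closedNeighbour w b)                                                  ≡⟨ ∑-↑ n0 m (λ w → closedNeighbour w b) ⟩
    ∑ {n0} (λ k → closedNeighbour (k ↑ˡ m) b) + ∑ {m} (λ u → closedNeighbour (n0 ↑ʳ u) b)
      ≡⟨ cong₂ _+_ (sum-cong-≗ (λ k → cong (λ p → ind (compatible p (partOf b))) (partOf-↑ˡ k)))
                   (sum-cong-≗ (λ u → cong₂ (λ p q → ind (compatible p q)) (partOf-↑ʳ u) b≡β)) ⟩
    ∑ {n0} (λ _ → + 1) + ∑ {m} (λ u → ind (blk u ℕ.≡ᵇ β))
      ≡⟨ cong₂ _+_ (∑-const-1 n0) (∑-block-indicator ns β) ⟩
    + n0 + + blockSize ns β                                                        ≡⟨ sym (ℤₚ.pos-+ n0 (blockSize ns β)) ⟩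
    + (n0 ℕ.+ blockSize ns β)                                                      ∎
    where open ≡-Reasoning

  adjacent-heads-decoupled : ∀ {i j j′} → toℕ i < toℕ j → toℕ i < toℕ j′ → j ≢ j′ → G i j ≡ true → G i j′ ≡ true →
    G j j′ ≡ true → entry G (i , j) (i , j′) ≡ + 0
  adjacent-heads-decoupled i<j i<j′ j≢j′ ij ij′ jj′ =
    trans (entry-same-tail-symmetric G G-sym G-irrefl i<j i<j′ j≢j′ ij ij′) (cong (λ t → + 1 - ind t) jj′)

  G-outer : ∀ {u w} → u ≢ w → G (n0 ↑ʳ u) (n0 ↑ʳ w) ≡ (blk u ℕ.≡ᵇ blk w)
  G-outer {u} {w} u≢w = trans (G-≢ (u≢w ∘ Finₚ.↑ʳ-injective n0 u w)) (cong₂ compatible (partOf-↑ʳ u) (partOf-↑ʳ w))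

  later-neighbour-same-part : ∀ {u j} → toℕ (n0 ↑ʳ u) < toℕ j → G (n0 ↑ʳ u) j ≡ true → partOf j ≡ partOf (n0 ↑ʳ u)
  later-neighbour-same-part {u} {j} u<j uj with proj₂ (adjacent⇒ uj)
  ... | inj₁ u≡0        = ⊥-elim (ℕₚ.1+n≢0 (trans (sym (partOf-↑ʳ u)) u≡0))
  ... | inj₂ (inj₁ j≡0) = ⊥-elim (ℕₚ.<-asym u<j (ℕₚ.<-≤-trans (partOf≡0⇒inner j j≡0)
                            (subst (n0 ≤_) (sym (Finₚ.toℕ-↑ʳ n0 u)) (ℕₚ.m≤m+n n0 (toℕ u)))))
  ... | inj₂ (inj₂ u≡j) = sym u≡j

  inner-adjacent : ∀ k {v} → k ↑ˡ m ≢ v → G (k ↑ˡ m) v ≡ true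
  inner-adjacent k k≢v = ⇒adjacent k≢v (inj₁ (partOf-↑ˡ k))

-- The characteristic polynomial

choose2 : ℕ → ℕ
choose2 zero    = 0
choose2 (suc n) = n ℕ.+ choose2 n

choose2-*2 : ∀ n → choose2 n ℕ.* 2 ≡ n ℕ.* (n ∸ 1)
choose2-*2 zero          = refl
choose2-*2 (suc zero)    = refl
choose2-*2 (suc (suc n)) = begin
  (suc n ℕ.+ choose2 (suc n)) ℕ.* 2       ≡⟨ ℕₚ.*-distribʳ-+ 2 (suc n) (choose2 (suc n)) ⟩
  suc n ℕ.* 2 ℕ.+ choose2 (suc n) ℕ.* 2   ≡⟨ cong (suc n ℕ.* 2 ℕ.+_) (choose2-*2 (suc n)) ⟩
  suc n ℕ.* 2 ℕ.+ suc n ℕ.* n             ≡⟨ step n ⟩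
  suc (suc n) ℕ.* suc n                   ∎
  where
  open ≡-Reasoning
  step : ∀ n → suc n ℕ.* 2 ℕ.+ suc n ℕ.* n ≡ suc (suc n) ℕ.* suc n
  step = ℕ-Solver.solve-∀

exponent-whole : ∀ n0 → (n0 ℕ.* (n0 ℕ.+ 1)) ℕ./ 2 ≡ choose2 n0 ℕ.+ n0
exponent-whole n0 = trans (cong (ℕ._/ 2) (sym (doubled n0))) (m*n/n≡m (choose2 n0 ℕ.+ n0) 2)
  where
  step : ∀ a → suc a ℕ.* a ℕ.+ suc a ℕ.* 2 ≡ suc a ℕ.* (suc a ℕ.+ 1)
  step = ℕ-Solver.solve-∀
  doubled : ∀ n0 → (choose2 n0 ℕ.+ n0) ℕ.* 2 ≡ n0 ℕ.* (n0 ℕ.+ 1)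
  doubled zero    = refl
  doubled (suc a) = trans (ℕₚ.*-distribʳ-+ 2 (choose2 (suc a)) (suc a))
    (trans (cong (ℕ._+ suc a ℕ.* 2) (choose2-*2 (suc a))) (step a))

exponent-block : ∀ n0 n → ((2 ℕ.* n0 ℕ.+ n) ℕ.* (n ∸ 1)) ℕ./ 2 ≡ (n ∸ 1) ℕ.* n0 ℕ.+ choose2 n
exponent-block n0 n = trans (cong (ℕ._/ 2) (sym doubled)) (m*n/n≡m ((n ∸ 1) ℕ.* n0 ℕ.+ choose2 n) 2)
  where
  step : ∀ n0 n t → t ℕ.* n0 ℕ.* 2 ℕ.+ n ℕ.* t ≡ (2 ℕ.* n0 ℕ.+ n) ℕ.* t
  step = ℕ-Solver.solve-∀
  doubled : ((n ∸ 1) ℕ.* n0 ℕ.+ choose2 n) ℕ.* 2 ≡ (2 ℕ.* n0 ℕ.+ n) ℕ.* (n ∸ 1)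
  doubled = trans (ℕₚ.*-distribʳ-+ 2 ((n ∸ 1) ℕ.* n0) (choose2 n))
    (trans (cong ((n ∸ 1) ℕ.* n0 ℕ.* 2 ℕ.+_) (choose2-*2 n)) (step n0 n (n ∸ 1)))

∏-choose2 : ∀ n X → ∏ {n} (λ k → X ^ (n ∸ suc (toℕ k))) ≡ X ^ choose2 n
∏-choose2 zero    X = refl
∏-choose2 (suc n) X = trans (cong (X ^ n *_) (∏-choose2 n X)) (sym (ℤₚ.^-distribˡ-+-* X n (choose2 n)))

^-distribʳ-* : ∀ a b n → (a * b) ^ n ≡ a ^ n * b ^ n
^-distribʳ-* a b zero    = refl
^-distribʳ-* a b (suc n) = trans (cong (a * b *_) (^-distribʳ-* a b n)) (interchange a b (a ^ n) (b ^ n))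
  where
  interchange : ∀ a b c d → a * b * (c * d) ≡ a * c * (b * d)
  interchange = solve-∀

productℤ-map-* : ∀ {A : Set} (f g : A → ℤ) xs → productℤ (map f xs) * productℤ (map g xs) ≡ productℤ (map (λ a → f a * g a) xs)
productℤ-map-* f g []       = refl
productℤ-map-* f g (x ∷ xs) = trans (interchange (f x) (g x) (productℤ (map f xs)) (productℤ (map g xs)))
  (cong (f x * g x *_) (productℤ-map-* f g xs))
  where
  interchange : ∀ a b c d → a * c * (b * d) ≡ a * b * (c * d)
  interchange = solve-∀

productℤ-map-^ : ∀ {A : Set} (f : A → ℤ) xs e → productℤ (map f xs) ^ e ≡ productℤ (map (λ a → f a ^ e) xs)
productℤ-map-^ f []       e = ℤₚ.^-zeroˡ e
productℤ-map-^ f (x ∷ xs) e = trans (^-distribʳ-* (f x) (productℤ (map f xs)) e) (cong (f x ^ e *_) (productℤ-map-^ f xs e))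

productℤ-map-cong : ∀ {A : Set} {f g : A → ℤ} xs → (∀ a → f a ≡ g a) → productℤ (map f xs) ≡ productℤ (map g xs)
productℤ-map-cong xs f≗g = cong productℤ (Listₚ.map-cong f≗g xs)

sameBlockLater : (ℕ → ℤ) → (ns : List ℕ) → Fin (sum ns) → Fin (sum ns) → ℤ
sameBlockLater c ns u w =
  if (u <F w) ∧ (blockOf ns (toℕ u) ℕ.≡ᵇ blockOf ns (toℕ w)) then c (blockSize ns (blockOf ns (toℕ u))) else + 1

∏-sameBlockLater : ∀ c ns → ∏ (λ u → ∏ (sameBlockLater c ns u)) ≡ productℤ (map (λ n → c n ^ choose2 n) ns)
∏-sameBlockLater c []       = refl
∏-sameBlockLater c (n ∷ ns) = begin
  ∏ (λ u → ∏ (row u))                                                 ≡⟨ ∏-↑ n S (λ u → ∏ (row u)) ⟩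
  ∏ {n} (λ k → ∏ (row (k ↑ˡ S))) * ∏ {S} (λ u → ∏ (row (n ↑ʳ u)))    ≡⟨ cong₂ _*_ (trans (∏-cong first-block) (∏-choose2 n (c n)))
                                                                                     (trans (∏-cong later-blocks) (∏-sameBlockLater c ns)) ⟩
  c n ^ choose2 n * productℤ (map (λ n → c n ^ choose2 n) ns)         ∎
  where
  open ≡-Reasoning
  S = sum ns
  row = sameBlockLater c (n ∷ ns)
  first-first : ∀ k k′ → row (k ↑ˡ S) (k′ ↑ˡ S) ≡ (if toℕ k ℕ.<ᵇ toℕ k′ then c n else + 1)
  first-first k k′ rewrite <F-↑ˡ S k k′ | blockOf-↑ˡ n ns k | blockOf-↑ˡ n ns k′ =
    cong (λ t → if t then c n else + 1) (∧-identityʳ (toℕ k ℕ.<ᵇ toℕ k′))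
  first-later : ∀ k w → row (k ↑ˡ S) (n ↑ʳ w) ≡ + 1
  first-later k w rewrite blockOf-↑ˡ n ns k | blockOf-↑ʳ n ns w =
    cong (λ t → if t then c n else + 1) (∧-zeroʳ ((k ↑ˡ S) <F (n ↑ʳ w)))
  later-first : ∀ u k → row (n ↑ʳ u) (k ↑ˡ S) ≡ + 1
  later-first u k rewrite blockOf-↑ʳ n ns u | blockOf-↑ˡ n ns k =
    cong (λ t → if t then c (blockSize ns (blockOf ns (toℕ u))) else + 1) (∧-zeroʳ ((n ↑ʳ u) <F (k ↑ˡ S)))
  later-later : ∀ u w → row (n ↑ʳ u) (n ↑ʳ w) ≡ sameBlockLater c ns u w
  later-later u w rewrite <F-↑ʳ n u w | blockOf-↑ʳ n ns u | blockOf-↑ʳ n ns w = refl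
  first-block : ∀ k → ∏ (row (k ↑ˡ S)) ≡ c n ^ (n ∸ suc (toℕ k))
  first-block k = begin
    ∏ (row (k ↑ˡ S))                                                  ≡⟨ ∏-↑ n S (row (k ↑ˡ S)) ⟩
    ∏ {n} (λ k′ → row (k ↑ˡ S) (k′ ↑ˡ S)) * ∏ {S} (λ w → row (k ↑ˡ S) (n ↑ʳ w))
                                                                      ≡⟨ cong₂ _*_ (trans (∏-cong (first-first k)) (∏-after n k (c n)))
                                                                                   (trans (∏-cong (first-later k)) (∏-const-1 S)) ⟩
    c n ^ (n ∸ suc (toℕ k)) * + 1                                     ≡⟨ ℤₚ.*-identityʳ _ ⟩
    c n ^ (n ∸ suc (toℕ k))                                           ∎
  later-blocks : ∀ u → ∏ (row (n ↑ʳ u)) ≡ ∏ (sameBlockLater c ns u)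
  later-blocks u = begin
    ∏ (row (n ↑ʳ u))                                                  ≡⟨ ∏-↑ n S (row (n ↑ʳ u)) ⟩
    ∏ {n} (λ k → row (n ↑ʳ u) (k ↑ˡ S)) * ∏ {S} (λ w → row (n ↑ʳ u) (n ↑ʳ w))
                                                                      ≡⟨ cong₂ _*_ (trans (∏-cong (later-first u)) (∏-const-1 n))
                                                                                   (∏-cong (later-later u)) ⟩
    + 1 * ∏ (sameBlockLater c ns u)                                   ≡⟨ ℤₚ.*-identityˡ _ ⟩
    ∏ (sameBlockLater c ns u)                                         ∎

module JoinGraphSpectrum (n0 : ℕ) (ns : List ℕ) (x : ℤ) where
  open JoinGraph n0 ns
  module E = EdgeMatrix G x

  c : ℕ → ℤ
  c n = x - + (n0 ℕ.+ n)

  tails-decoupled : ∀ k k′ → k Fin.< k′ → E.Decoupled (edgesFrom G k) (edgesFrom G k′)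
  tails-decoupled k k′ k<k′ = All.map (λ { (j , refl , k<j , kj) → All.map (λ { (j′ , refl , k′<j′ , k′j′) →
      cong (_-_ (+ 0)) (entry-join-different-tails k<j k′<j′ k<k′ kj k′j′) }) (edgesFrom-edge G k′) }) (edgesFrom-edge G k)

  charPolyAt-by-tail : charPolyAt (helmholtzian G) x ≡ ∏ (λ i → E.detL (edgesFrom G i))
  charPolyAt-by-tail = trans (charPolyAt-helmholtzian G x)
    (trans (cong E.detL (edges-by-tail G)) (E.detL-concat (edgesFrom G) tails-decoupled))

  pivot-inner : ∀ {a b} → toℕ a < toℕ b → G a b ≡ true → partOf b ≡ 0 → x - entry G (a , b) (a , b) ≡ x - + N
  pivot-inner a<b ab b≡0 = cong (_-_ x) (trans (entry-join-diagonal a<b ab) (closedNeighbourhood-inner b≡0))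

  pivot-outer : ∀ {a b} β → toℕ a < toℕ b → G a b ≡ true → partOf b ≡ suc β →
    x - entry G (a , b) (a , b) ≡ x - + (n0 ℕ.+ blockSize ns β)
  pivot-outer β a<b ab b≡β = cong (_-_ x) (trans (entry-join-diagonal a<b ab) (closedNeighbourhood-outer β b≡β))

  tail-outer : ∀ u → E.detL (edgesFrom G (n0 ↑ʳ u)) ≡ ∏ (sameBlockLater c ns u)
  tail-outer u = begin
    E.detL (edgesFrom G i)                                         ≡⟨ detL-heads G x i (λ j → j) heads-adjacent ⟩
    ∏ (headFactor G x i)                                           ≡⟨ ∏-↑ n0 m (headFactor G x i) ⟩
    ∏ {n0} (headFactor G x i ∘ (_↑ˡ m)) * ∏ {m} (headFactor G x i ∘ (n0 ↑ʳ_))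
                                                                   ≡⟨ cong₂ _*_ (trans (∏-cong inner-head) (∏-const-1 n0)) (∏-cong outer-head) ⟩
    + 1 * ∏ (sameBlockLater c ns u)                                ≡⟨ ℤₚ.*-identityˡ _ ⟩
    ∏ (sameBlockLater c ns u)                                      ∎
    where
    open ≡-Reasoning
    i = n0 ↑ʳ u
    heads-adjacent : ∀ j j′ → toℕ j < toℕ j′ → toℕ i < toℕ j → toℕ i < toℕ j′ → G i j ≡ true → G i j′ ≡ true →
      entry G (i , j) (i , j′) ≡ + 0
    heads-adjacent j j′ j<j′ i<j i<j′ ij ij′ = adjacent-heads-decoupled i<j i<j′ (<⇒≢ j<j′) ij ij′
      (⇒adjacent (<⇒≢ j<j′) (inj₂ (inj₂ (trans (later-neighbour-same-part i<j ij) (sym (later-neighbour-same-part i<j′ ij′))))))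
    inner-head : ∀ k → headFactor G x i (k ↑ˡ m) ≡ + 1
    inner-head k rewrite ≮⇒<F-false (ℕₚ.<-asym (↑ˡ<↑ʳ k u)) = refl
    outer-head : ∀ w → headFactor G x i (n0 ↑ʳ w) ≡ sameBlockLater c ns u w
    outer-head w with u <F w in u<w
    ... | false = cong (λ t → if t ∧ G i (n0 ↑ʳ w) then x - entry G (i , n0 ↑ʳ w) (i , n0 ↑ʳ w) else + 1) (trans (<F-↑ʳ n0 u w) u<w)
    ... | true  = trans (cong (λ t → if t then x - entry G (i , n0 ↑ʳ w) (i , n0 ↑ʳ w) else + 1)
                          (cong₂ _∧_ (trans (<F-↑ʳ n0 u w) u<w) (G-outer (<⇒≢ (<ᵇ⇒< {i = u} u<w)))))
                    same-block
      where
      same-block : (if blk u ℕ.≡ᵇ blk w then x - entry G (i , n0 ↑ʳ w) (i , n0 ↑ʳ w) else + 1)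
                   ≡ (if blk u ℕ.≡ᵇ blk w then c (blockSize ns (blk u)) else + 1)
      same-block with blk u ℕ.≡ᵇ blk w in u∼w
      ... | false = refl
      ... | true  = pivot-outer (blk u) (<ᵇ⇒< (trans (<F-↑ʳ n0 u w) u<w)) (trans (G-outer (<⇒≢ (<ᵇ⇒< {i = u} u<w))) u∼w)
                      (trans (partOf-↑ʳ w) (cong suc (sym (ℕₚ.≡ᵇ⇒≡ (blk u) (blk w) (Equivalence.from T-≡ u∼w)))))

  innerHeads outerHeads : Fin n0 → List (Fin N × Fin N)
  innerHeads k = concat (tabulate (edgeAt G (k ↑ˡ m) ∘ (_↑ˡ m)))
  outerHeads k = concat (tabulate (edgeAt G (k ↑ˡ m) ∘ (n0 ↑ʳ_)))

  edgesFrom-inner : ∀ k → edgesFrom G (k ↑ˡ m) ≡ innerHeads k ++ outerHeads k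
  edgesFrom-inner k = trans (cong concat (tabulate-↑ n0 m (edgeAt G (k ↑ˡ m))))
    (sym (Listₚ.concat-++ (tabulate (edgeAt G (k ↑ˡ m) ∘ (_↑ˡ m))) (tabulate (edgeAt G (k ↑ˡ m) ∘ (n0 ↑ʳ_)))))

  innerHeads-outerHeads-decoupled : ∀ k → E.Decoupled (innerHeads k) (outerHeads k)
  innerHeads-outerHeads-decoupled k =
    All.map (λ { (j , refl , i<j , ij) → All.map (λ { (w , refl , i<w , iw) →
        cong (_-_ (+ 0)) (adjacent-heads-decoupled i<j i<w (↑ˡ≢↑ʳ j w) ij iw (inner-adjacent j (↑ˡ≢↑ʳ j w))) })
      (concat⁺ (tabulate⁺ (λ w → All.map (w ,_) (edgeAt-edge G (k ↑ˡ m) (n0 ↑ʳ w))))) })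
    (concat⁺ (tabulate⁺ (λ j → All.map (j ,_) (edgeAt-edge G (k ↑ˡ m) (j ↑ˡ m)))))

  detL-innerHeads : ∀ k → E.detL (innerHeads k) ≡ (x - + N) ^ (n0 ∸ suc (toℕ k))
  detL-innerHeads k = trans (detL-heads G x i (_↑ˡ m) heads-adjacent) (trans (∏-cong head) (∏-after n0 k (x - + N)))
    where
    i = k ↑ˡ m
    heads-adjacent : ∀ j j′ → j Fin.< j′ → toℕ i < toℕ (j ↑ˡ m) → toℕ i < toℕ (j′ ↑ˡ m) →
      G i (j ↑ˡ m) ≡ true → G i (j′ ↑ˡ m) ≡ true →
      entry G (i , j ↑ˡ m) (i , j′ ↑ˡ m) ≡ + 0
    heads-adjacent j j′ j<j′ i<j i<j′ ij ij′ = adjacent-heads-decoupled i<j i<j′ j≢j′ ij ij′ (inner-adjacent j j≢j′)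
      where j≢j′ = <⇒≢ j<j′ ∘ Finₚ.↑ˡ-injective m j j′
    head : ∀ j → headFactor G x i (j ↑ˡ m) ≡ (if toℕ k ℕ.<ᵇ toℕ j then x - + N else + 1)
    head j with toℕ k ℕ.<ᵇ toℕ j in k<j
    ... | false = cong (λ t → if t ∧ G i (j ↑ˡ m) then x - entry G (i , j ↑ˡ m) (i , j ↑ˡ m) else + 1) (trans (<F-↑ˡ m k j) k<j)
    ... | true  = trans (cong (λ t → if t then x - entry G (i , j ↑ˡ m) (i , j ↑ˡ m) else + 1) (cong₂ _∧_ i<ᵇj ij))
                    (pivot-inner (<ᵇ⇒< i<ᵇj) ij (partOf-↑ˡ j))
      where
      i<ᵇj = trans (<F-↑ˡ m k j) k<j
      ij = inner-adjacent k (<⇒≢ (<ᵇ⇒< i<ᵇj))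

  detL-outerHeads : ∀ k → E.detL (outerHeads k) ≡ detL (clusters (x - + n0) 0 ns)
  detL-outerHeads k = begin
    E.detL (outerHeads k)                           ≡⟨ cong E.detL outerHeads-tabulate ⟩
    E.detL (tabulate φ)                             ≡⟨ E.detL-tabulate φ ⟩
    det (E.mat φ)                                   ≡⟨ det-cong entrywise ⟩
    det (mat (clusterAt (x - + n0) 0 ns))           ≡⟨ sym (detL-tabulate (clusterAt (x - + n0) 0 ns)) ⟩
    detL (tabulate (clusterAt (x - + n0) 0 ns))     ≡⟨ cong detL (sym (clusters-tabulate (x - + n0) 0 ns)) ⟩
    detL (clusters (x - + n0) 0 ns)                 ∎
    where
    open ≡-Reasoning
    i = k ↑ˡ m
    φ : Fin m → Fin N × Fin N
    φ w = i , n0 ↑ʳ w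
    outerHeads-tabulate : outerHeads k ≡ tabulate φ
    outerHeads-tabulate = begin
      outerHeads k
        ≡⟨ cong concat (Listₚ.tabulate-cong (λ w → edgeAt-present G (↑ˡ<↑ʳ k w) (inner-adjacent k (↑ˡ≢↑ʳ k w)))) ⟩
      concat (tabulate (λ w → φ w ∷ []))         ≡⟨ cong concat (sym (Listₚ.map-tabulate φ (_∷ []))) ⟩
      concat (map (_∷ []) (tabulate φ))          ≡⟨ Listₚ.concat-map-[_] (tabulate φ) ⟩
      tabulate φ                                 ∎
    entrywise : ∀ u w → E.mat φ u w ≡ mat (clusterAt (x - + n0) 0 ns) u w
    entrywise u w with u Fin.≟ w
    ... | yes refl = trans (pivot-outer (blk u) (↑ˡ<↑ʳ k u) (inner-adjacent k (↑ˡ≢↑ʳ k u)) (partOf-↑ʳ u))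
                       (trans (cong (_-_ x) (ℤₚ.pos-+ n0 (blockSize ns (blk u)))) (reassociate x (+ n0) (+ blockSize ns (blk u))))
      where
      reassociate : ∀ a b c → a - (b + c) ≡ a - b - c
      reassociate = solve-∀
    ... | no u≢w = trans (cong (_-_ (+ 0)) (trans same-tail (cong (λ t → + 1 - ind t) (G-outer u≢w))))
                     (by-block (blk u ℕ.≡ᵇ blk w))
      where
      same-tail = entry-same-tail-symmetric G G-sym G-irrefl (↑ˡ<↑ʳ k u) (↑ˡ<↑ʳ k w) (u≢w ∘ Finₚ.↑ʳ-injective n0 u w)
                    (inner-adjacent k (↑ˡ≢↑ʳ k u)) (inner-adjacent k (↑ˡ≢↑ʳ k w))
      by-block : ∀ b → + 0 - (+ 1 - ind b) ≡ (if b then + 0 else - + 1)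
      by-block true  = refl
      by-block false = refl

  tail-inner : ∀ k → E.detL (edgesFrom G (k ↑ˡ m)) ≡ (x - + N) ^ (n0 ∸ suc (toℕ k)) * detL (clusters (x - + n0) 0 ns)
  tail-inner k = begin
    E.detL (edgesFrom G (k ↑ˡ m))                       ≡⟨ cong E.detL (edgesFrom-inner k) ⟩
    E.detL (innerHeads k ++ outerHeads k)               ≡⟨ E.detL-++ (innerHeads k) (outerHeads k) (innerHeads-outerHeads-decoupled k) ⟩
    E.detL (innerHeads k) * E.detL (outerHeads k)       ≡⟨ cong₂ _*_ (detL-innerHeads k) (detL-outerHeads k) ⟩
    (x - + N) ^ (n0 ∸ suc (toℕ k)) * detL (clusters (x - + n0) 0 ns) ∎
    where open ≡-Reasoning

  charPolyAt-factorised : charPolyAt (helmholtzian G) x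
    ≡ (x - + N) ^ choose2 n0 * detL (clusters (x - + n0) 0 ns) ^ n0 * productℤ (map (λ n → (x - + (n0 ℕ.+ n)) ^ choose2 n) ns)
  charPolyAt-factorised = begin
    charPolyAt (helmholtzian G) x                                            ≡⟨ charPolyAt-by-tail ⟩
    ∏ (λ i → E.detL (edgesFrom G i))                                         ≡⟨ ∏-↑ n0 m (λ i → E.detL (edgesFrom G i)) ⟩
    ∏ {n0} (λ k → E.detL (edgesFrom G (k ↑ˡ m))) * ∏ {m} (λ u → E.detL (edgesFrom G (n0 ↑ʳ u)))
                                                                             ≡⟨ cong₂ _*_ (∏-cong tail-inner) (∏-cong tail-outer) ⟩
    ∏ {n0} (λ k → (x - + N) ^ (n0 ∸ suc (toℕ k)) * M) * ∏ (λ u → ∏ (sameBlockLater c ns u))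
      ≡⟨ cong₂ _*_ (trans (∏-distrib-* {n0} (λ k → (x - + N) ^ (n0 ∸ suc (toℕ k))) (λ _ → M))
                          (cong₂ _*_ (∏-choose2 n0 (x - + N)) (∏-const n0 M)))
                   (∏-sameBlockLater c ns) ⟩
    (x - + N) ^ choose2 n0 * M ^ n0 * productℤ (map (λ n → c n ^ choose2 n) ns) ∎
    where
    open ≡-Reasoning
    M = detL (clusters (x - + n0) 0 ns)

specPoly-factorised : ∀ n0 ns x → let y = x - + n0; c = λ n → x - + (n0 ℕ.+ n) in
  (x - + (n0 ℕ.+ sum ns)) ^ choose2 n0
    * (y ^ (length ns ∸ 1) * (y - + sum ns) * productℤ (map (λ n → (y - + n) ^ (n ∸ 1)) ns)) ^ n0
    * productℤ (map (λ n → c n ^ choose2 n) ns)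
  ≡ specPoly n0 ns x
specPoly-factorised n0 ns x = begin
  X ^ choose2 n0 * (y ^ k * (y - + sum ns) * P) ^ n0 * Q
    ≡⟨ cong (λ t → X ^ choose2 n0 * t * Q) (trans (^-distribʳ-* (y ^ k * (y - + sum ns)) P n0)
                                              (cong (_* P ^ n0) (^-distribʳ-* (y ^ k) (y - + sum ns) n0))) ⟩
  X ^ choose2 n0 * ((y ^ k) ^ n0 * (y - + sum ns) ^ n0 * P ^ n0) * Q
    ≡⟨ cong₂ (λ s t → X ^ choose2 n0 * (s * t ^ n0 * P ^ n0) * Q)
         (trans (ℤₚ.^-*-assoc y k n0) (cong (y ^_) (ℕₚ.*-comm k n0))) (shift (sum ns)) ⟩
  X ^ choose2 n0 * (y ^ (n0 ℕ.* k) * X ^ n0 * P ^ n0) * Q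
    ≡⟨ regroup (X ^ choose2 n0) (y ^ (n0 ℕ.* k)) (X ^ n0) (P ^ n0) Q ⟩
  (X ^ choose2 n0 * X ^ n0) * (y ^ (n0 ℕ.* k) * (P ^ n0 * Q))
    ≡⟨ cong₂ (λ s t → s * (y ^ (n0 ℕ.* k) * t))
         (trans (sym (ℤₚ.^-distribˡ-+-* X (choose2 n0) n0)) (cong (X ^_) (sym (exponent-whole n0))))
         (trans (cong (_* Q) (productℤ-map-^ (λ n → (y - + n) ^ (n ∸ 1)) ns n0))
           (trans (productℤ-map-* (λ n → ((y - + n) ^ (n ∸ 1)) ^ n0) (λ n → c n ^ choose2 n) ns)
             (productℤ-map-cong ns block-factor))) ⟩
  specPoly n0 ns x ∎
  where
  open ≡-Reasoning
  y = x - + n0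
  X = x - + (n0 ℕ.+ sum ns)
  k = length ns ∸ 1
  c : ℕ → ℤ
  c n = x - + (n0 ℕ.+ n)
  P = productℤ (map (λ n → (y - + n) ^ (n ∸ 1)) ns)
  Q = productℤ (map (λ n → c n ^ choose2 n) ns)
  regroup : ∀ a b c d e → a * (b * c * d) * e ≡ (a * c) * (b * (d * e))
  regroup = solve-∀
  shift : ∀ n → y - + n ≡ c n
  shift n = trans (reassociate x (+ n0) (+ n)) (cong (_-_ x) (sym (ℤₚ.pos-+ n0 n)))
    where
    reassociate : ∀ a b c → a - b - c ≡ a - (b + c)
    reassociate = solve-∀
  block-factor : ∀ n → ((y - + n) ^ (n ∸ 1)) ^ n0 * c n ^ choose2 n ≡ c n ^ (((2 ℕ.* n0 ℕ.+ n) ℕ.* (n ∸ 1)) ℕ./ 2)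
  block-factor n = begin
    ((y - + n) ^ (n ∸ 1)) ^ n0 * c n ^ choose2 n      ≡⟨ cong (λ t → (t ^ (n ∸ 1)) ^ n0 * c n ^ choose2 n) (shift n) ⟩
    (c n ^ (n ∸ 1)) ^ n0 * c n ^ choose2 n            ≡⟨ cong (_* c n ^ choose2 n) (ℤₚ.^-*-assoc (c n) (n ∸ 1) n0) ⟩
    c n ^ ((n ∸ 1) ℕ.* n0) * c n ^ choose2 n          ≡⟨ sym (ℤₚ.^-distribˡ-+-* (c n) ((n ∸ 1) ℕ.* n0) (choose2 n)) ⟩
    c n ^ ((n ∸ 1) ℕ.* n0 ℕ.+ choose2 n)              ≡⟨ cong (c n ^_) (sym (exponent-block n0 n)) ⟩
    c n ^ (((2 ℕ.* n0 ℕ.+ n) ℕ.* (n ∸ 1)) ℕ./ 2)      ∎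

proposition3p7 : (n0 : ℕ) (ns : List ℕ) → 1 ≤ n0 → All (1 ≤_) ns → 1 ≤ length ns →
    (x : ℤ) → charPolyAt (helmholtzian (joinGraph n0 ns)) x ≡ specPoly n0 ns x
proposition3p7 n0 ns _ blocks-nonempty some-block x = begin
  charPolyAt (helmholtzian (joinGraph n0 ns)) x
    ≡⟨ JoinGraphSpectrum.charPolyAt-factorised n0 ns x ⟩
  (x - + (n0 ℕ.+ sum ns)) ^ choose2 n0 * detL (clusters y 0 ns) ^ n0 * Q
    ≡⟨ cong (λ d → (x - + (n0 ℕ.+ sum ns)) ^ choose2 n0 * d ^ n0 * Q) (detL-clusters y ns blocks-nonempty some-block) ⟩
  (x - + (n0 ℕ.+ sum ns)) ^ choose2 n0 * (y ^ (length ns ∸ 1) * (y - + sum ns) * productℤ (map (λ n → (y - + n) ^ (n ∸ 1)) ns)) ^ n0 * Q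
    ≡⟨ specPoly-factorised n0 ns x ⟩
  specPoly n0 ns x ∎
  where
  open ≡-Reasoning
  y = x - + n0
  Q = productℤ (map (λ n → (x - + (n0 ℕ.+ n)) ^ choose2 n) ns)
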